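{- Let $\Bbbk$ be a field of characteristic zero, $\alpha,\beta\in\Bbbk^\times$, $b\in\Bbbk$, and let $A$ be the $\Bbbk$-algebra generated by $x,y,z$ subject to $$yz-\alpha zy=0,\qquad zx-\beta xz=y+b,\qquad xy-\alpha yx=0.$$ For $r\ge1$ let $\langle r\rangle_{\beta,\alpha^{ -1}}:=\sum_{j=0}^{r-1}\beta^{r-1-j}\alpha^{ -j}$ and $P_r(y):=\langle r\rangle_{\beta,\alpha^{ -1}}\,y+b[r]_\beta\in\Bbbk[y]$. Then: (1) For all $m,n\in\mathbb{N}$, $y^nx^m=\alpha^{ -mn}x^my^n$ and $z^ny^m=\alpha^{ -mn}y^mz^n$. For all $m,n\in\mathbb{N}$ there exist unique $W^{(m)}_{n,k}(y)\in\Bbbk[y]$, $0\le k\le\min\{m,n\}$, with $z^nx^m=\sum_{k=0}^{\min\{m,n\}}x^{m-k}W^{(m)}_{n,k}(y)z^{n-k}$; they are characterized by $W^{(m)}_{0,0}(y)=1$, $W^{(m)}_{0,k}(y)=0$ ($k\ge1$), and, with $W^{(m)}_{n,-1}(y):=0$, for $n,k\ge0$: $$W^{(m)}_{n+1,k}(y)=\beta^{m-k}W^{(m)}_{n,k}(\alpha^{ -1}y)+P_{m-k+1}(y)W^{(m)}_{n,k-1}(y).$$ (2) For all $m,n,s\in\mathbb{N}$, $(x^ny^m)^s=\alpha^{ -mn\binom s2}x^{ns}y^{ms}$ and $(y^nz^m)^s=\alpha^{ -mn\binom s2}y^{ns}z^{ms}$. Moreover $(x^nz^m)^s=\sum_{\ell=0}^{\min\{ns,ms\}}x^{ns-\ell}U^{(n,m)}_{s,\ell}(y)z^{ms-\ell}$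 with $U^{(n,m)}_{s,\ell}(y)\in\Bbbk[y]$, $U^{(n,m)}_{1,0}=1$, $U^{(n,m)}_{1,\ell}=0$ ($\ell\ge1$), and for $s\ge1,\ell\ge0$: $$U^{(n,m)}_{s+1,\ell}(y)=\sum_{k=0}^{\min\{n,\ell\}}U^{(n,m)}_{s,\ell-k}(\alpha^{ -(n-k)}y)\,W^{(n)}_{ms-(\ell-k),k}(y).$$ (3) There exist unique $V_{s,\ell}(y)\in\Bbbk[y]$ ($0\le\ell\le s$) with $(xyz)^s=\sum_{\ell=0}^sx^{s-\ell}V_{s,\ell}(y)z^{s-\ell}$; $V_{1,0}(y)=y$, $V_{1,\ell}(y)=0$ ($\ell\ge1$), and for $s\ge1,\ell\ge0$, with $V_{s,-1}(y):=0$: $$V_{s+1,\ell}(y)=\alpha^{ -(s-\ell)}y\Big(\beta^{s-\ell}V_{s,\ell}(\alpha^{ -1}y)+P_{s-\ell+1}(y)V_{s,\ell-1}(y)\Big).$$ (4) For all $n,m,t,s\in\mathbb{N}$ there exist unique $R^{(n,m,t)}_{s,\ell}(y)\in\Bbbk[y]$, $0\le\ell\le\min\{ns,ts\}$, with $(x^ny^mz^t)^s=\sum_{\ell=0}^{\min\{ns,ts\}}x^{ns-\ell}R^{(n,m,t)}_{s,\ell}(y)z^{ts-\ell}$; $R^{(n,m,t)}_{1,0}(y)=y^m$, $R^{(n,m,t)}_{1,\ell}(y)=0$ ($\ell\ge1$), and for $s\ge1,\ell\ge0$: $$R^{(n,m,t)}_{s+1,\ell}(y)=\alpha^{ -(ts-\ell)m}y^m\sum_{k=0}^{\min\{n,\ell\}}R^{(n,m,t)}_{s,\ell-k}(\alpha^{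 -(n-k)}y)\,W^{(n)}_{ts-(\ell-k),k}(y).$$ (5) $(x+y)^n=\sum_{k=0}^n\begin{bmatrix}n\\k\end{bmatrix}_{\alpha^{ -1}}x^{n-k}y^k$ and $(y+z)^n=\sum_{k=0}^n\begin{bmatrix}n\\k\end{bmatrix}_{\alpha^{ -1}}y^{n-k}z^k$. Finally $(x+z)^n=\sum_{i,k\ge0,\ i+k\le n}x^iE_{n;i,k}(y)z^k$ uniquely with $E_{n;i,k}(y)\in\Bbbk[y]$, $E_{0;0,0}=1$, $E_{0;i,k}=0$ for $(i,k)\ne(0,0)$, and $$E_{n+1;i,k}(y)=E_{n;i,k-1}(y)+\beta^kE_{n;i-1,k}(\alpha^{ -1}y)+P_{k+1}(y)E_{n;i,k+1}(y),$$ where $E_{n;i,k}(y)=0$ if $i<0$, $k<0$ or $i+k>n$.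
   Context: $\mathbb{N}$ includes $0$; $\binom s2=s(s-1)/2$. For $q\in\Bbbk^\times$: $[r]_q=1+q+\cdots+q^{r-1}$ ($[0]_q=0$), $[r]_q!=\prod_{j=1}^r[j]_q$ ($[0]_q!=1$), $\begin{bmatrix}r\\k\end{bmatrix}_q=\frac{[r]_q!}{[r-k]_q![k]_q!}$ for $0\le k\le r$ and $0$ if $k>r$. The standard monomials $x^iy^jz^k$ form a $\Bbbk$-basis of $A$ (PBW basis); uniqueness refers to expansions in this basis, with polynomials in $y$ placed between the $x$-power and the $z$-power. Coefficients with a negative index are zero; empty sums are $0$, empty products $1$. -}

module Defs where

open import Level using (Level; _⊔_) renaming (suc to lsuc)
open import Data.Nat using (ℕ; zero; suc; _∸_; _≤ᵇ_; _⊓_)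
  renaming (_*_ to _*ℕ_; _+_ to _+ℕ_)
open import Data.Integer using (ℤ; +_; -[1+_])
open import Data.Bool using (if_then_else_)
open import Data.List using (List; []; _∷_)
open import Data.Product using (Σ; ∃)
open import Relation.Nullary using (¬_)
open import Algebra.Bundles using (CommutativeRing; Ring)

record Field (c ℓ : Level) : Set (lsuc (c ⊔ ℓ)) where
  field
    commutativeRing : CommutativeRing c ℓ
  open CommutativeRing commutativeRing public
  field
    1≉0     : ¬ (1# ≈ 0#)
    inverse : ∀ a → ¬ (a ≈ 0#) → Σ Carrier (λ a⁻¹ → a * a⁻¹ ≈ 1#)

  fromℕ : ℕ → Carrier
  fromℕ zero    = 0#
  fromℕ (suc n) = 1# + fromℕ n

  _^_ : Carrier → ℕ → Carrier
  a ^ zero  = 1#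
  a ^ suc n = a * (a ^ n)

CharZero : ∀ {c ℓ} → Field c ℓ → Set ℓ
CharZero F = ∀ n → ¬ (fromℕ (suc n) ≈ 0#)
  where open Field F

-- Associative unital algebras over a field F: a ring A together with a
-- unital ring homomorphism ι : F → A whose image is central
-- (scalar multiplication c·a := ι c * a).

record FAlgebra {c ℓ} (F : Field c ℓ) (a ℓa : Level) : Set (c ⊔ ℓ ⊔ lsuc (a ⊔ ℓa)) where
  private module K = Field F
  field
    ring : Ring a ℓa
  open Ring ring public
  field
    ι         : K.Carrier → Carrier
    ι-cong    : ∀ {p q} → p K.≈ q → ι p ≈ ι q
    ι-+       : ∀ p q → ι (p K.+ q) ≈ ι p + ι q
    ι-*       : ∀ p q → ι (p K.* q) ≈ ι p * ι q
    ι-1       : ι K.1# ≈ 1#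
    ι-central : ∀ p u → ι p * u ≈ u * ι p

  _^_ : Carrier → ℕ → Carrier
  u ^ zero  = 1#
  u ^ suc n = u * (u ^ n)

  -- Σ≤ n f = f 0 + f 1 + ... + f n   (inclusive upper bound)
  Σ≤ : ℕ → (ℕ → Carrier) → Carrier
  Σ≤ zero    f = f 0
  Σ≤ (suc n) f = Σ≤ n f + f (suc n)

-- Polynomials in one variable over F, as coefficient lists
-- (constant term first).  Equality is coefficientwise, so trailing
-- zeros are irrelevant.

module Poly {c ℓ} (F : Field c ℓ) where
  open Field F

  Pol : Set c
  Pol = List Carrier

  coeff : Pol → ℕ → Carrier
  coeff []      _       = 0#
  coeff (a ∷ p) zero    = a
  coeff (a ∷ p) (suc i) = coeff p i

  infix 4 _≋_
  _≋_ : Pol → Pol → Set ℓ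
  p ≋ q = ∀ i → coeff p i ≈ coeff q i

  0P 1P yP : Pol
  0P = []
  1P = 1# ∷ []
  yP = 0# ∷ 1# ∷ []

  yPow : ℕ → Pol
  yPow zero    = 1P
  yPow (suc m) = 0# ∷ yPow m

  infixl 6 _+P_
  infixl 7 _*P_
  _+P_ : Pol → Pol → Pol
  []      +P q       = q
  (a ∷ p) +P []      = a ∷ p
  (a ∷ p) +P (b ∷ q) = (a + b) ∷ (p +P q)

  scaleP : Carrier → Pol → Pol
  scaleP a []      = []
  scaleP a (b ∷ p) = (a * b) ∷ scaleP a p

  _*P_ : Pol → Pol → Pol
  []      *P q = []
  (a ∷ p) *P q = scaleP a q +P (0# ∷ (p *P q))

  -- substitution y ↦ a·y :  (substP p a)(y) = p(a y)
  substP : Pol → Carrier → Pol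
  substP []      a = []
  substP (b ∷ p) a = b ∷ scaleP a (substP p a)

  ΣP≤ : ℕ → (ℕ → Pol) → Pol
  ΣP≤ zero    f = f 0
  ΣP≤ (suc n) f = ΣP≤ n f +P f (suc n)

  evalP : ∀ {a ℓa} (A : FAlgebra F a ℓa) → Pol → FAlgebra.Carrier A → FAlgebra.Carrier A
  evalP A []      u = FAlgebra.0# A
  evalP A (b ∷ p) u = FAlgebra._+_ A (FAlgebra.ι A b) (FAlgebra._*_ A u (evalP A p u))

-- The scalars and polynomial families of Proposition 3.9.
-- Parameters: α, αi (intended: αi = α⁻¹), β, b.

module Families {c ℓ} (F : Field c ℓ) (α αi β b : Field.Carrier F) where
  open Field F
  open Poly F

  -- α ^ (- e) for an integer exponent e
  α^-_ : ℤ → Carrier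
  α^- (+ n)    = αi ^ n
  α^- -[1+ n ] = α ^ suc n

  Σ< : ℕ → (ℕ → Carrier) → Carrier
  Σ< zero    f = 0#
  Σ< (suc r) f = Σ< r f + f r

  ⟨_⟩ : ℕ → Carrier
  ⟨ r ⟩ = Σ< r (λ j → (β ^ (r ∸ 1 ∸ j)) * (αi ^ j))

  [_]_ : ℕ → Carrier → Carrier
  [ r ] q = Σ< r (λ j → q ^ j)

  P : ℕ → Pol
  P r = ((b * ([ r ] β)) ∷ []) +P scaleP ⟨ r ⟩ yP

  -- Gaussian binomial coefficient [n k]_q, via the q-Pascal rule
  -- [n+1, k+1]_q = [n, k]_q + q^{k+1} [n, k+1]_q  (its value as a
  -- polynomial in q, i.e. the paper's factorial quotient).
  qbin : Carrier → ℕ → ℕ → Carrier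
  qbin q zero    zero    = 1#
  qbin q zero    (suc k) = 0#
  qbin q (suc n) zero    = 1#
  qbin q (suc n) (suc k) = qbin q n k + (q ^ suc k) * qbin q n (suc k)

  W : ℕ → ℕ → ℕ → Pol
  W m zero    zero    = 1P
  W m zero    (suc k) = 0P
  W m (suc n) zero    = scaleP (β ^ m) (substP (W m n 0) αi)
  W m (suc n) (suc k) =
    if suc k ≤ᵇ m
    then scaleP (β ^ (m ∸ suc k)) (substP (W m n (suc k)) αi)
         +P P (suc (m ∸ suc k)) *P W m n k
    else 0P

  -- W^{(m)}_{N - d, k}, which is 0 when the first index N - d is negative
  W⁻ : ℕ → ℕ → ℕ → ℕ → Pol
  W⁻ m N d k = if d ≤ᵇ N then W m (N ∸ d) k else 0P

  -- U^{(n,m)}_{s,ℓ}(y) :  U n m s ℓ   (U_{0,0} = 1 encodes (x^n z^m)^0 = 1)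
  U : ℕ → ℕ → ℕ → ℕ → Pol
  U n m zero          zero    = 1P
  U n m zero          (suc ℓ) = 0P
  U n m (suc zero)    zero    = 1P
  U n m (suc zero)    (suc ℓ) = 0P
  U n m (suc (suc s)) ℓ =
    ΣP≤ (n ⊓ ℓ) (λ k →
      substP (U n m (suc s) (ℓ ∸ k)) (αi ^ (n ∸ k))
      *P W⁻ n (m *ℕ suc s) (ℓ ∸ k) k)

  -- V_{s,ℓ}(y) :  V s ℓ   (V_{0,0} = 1 encodes (xyz)^0 = 1; V_{s,ℓ} = 0 for ℓ > s)
  V : ℕ → ℕ → Pol
  V zero          zero    = 1P
  V zero          (suc ℓ) = 0P
  V (suc zero)    zero    = yP
  V (suc zero)    (suc ℓ) = 0P
  V (suc (suc s)) zero    =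
    scaleP (α^- (+ suc s)) (yP *P
      (scaleP (β ^ suc s) (substP (V (suc s) 0) αi)))
  V (suc (suc s)) (suc ℓ) =
    if suc ℓ ≤ᵇ suc (suc s)
    then scaleP (α^- (+ suc s Data.Integer.- + suc ℓ)) (yP *P
      (scaleP (β ^ (suc s ∸ suc ℓ)) (substP (V (suc s) (suc ℓ)) αi)
       +P P (suc (suc s) ∸ suc ℓ) *P V (suc s) ℓ))
    else 0P

  -- R^{(n,m,t)}_{s,ℓ}(y) :  R n m t s ℓ   (R_{0,0} = 1 encodes (x^n y^m z^t)^0 = 1)
  R : ℕ → ℕ → ℕ → ℕ → ℕ → Pol
  R n m t zero          zero    = 1P
  R n m t zero          (suc ℓ) = 0P
  R n m t (suc zero)    zero    = yPow m
  R n m t (suc zero)    (suc ℓ) = 0P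
  R n m t (suc (suc s)) ℓ =
    scaleP (α^- ((+ (t *ℕ suc s) Data.Integer.- + ℓ) Data.Integer.* + m))
      (yPow m *P
        ΣP≤ (n ⊓ ℓ) (λ k →
          substP (R n m t (suc s) (ℓ ∸ k)) (αi ^ (n ∸ k))
          *P W⁻ n (t *ℕ suc s) (ℓ ∸ k) k))

  E : ℕ → ℕ → ℕ → Pol
  E zero    zero    zero    = 1P
  E zero    zero    (suc k) = 0P
  E zero    (suc i) k       = 0P
  E (suc n) i k =
    if i +ℕ k ≤ᵇ suc n
    then Eₖ₋₁ k +P Eᵢ₋₁ i +P P (suc k) *P E n i (suc k)
    else 0P
    where
      Eₖ₋₁ : ℕ → Pol
      Eₖ₋₁ zero     = 0P
      Eₖ₋₁ (suc k′) = E n i k′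
      Eᵢ₋₁ : ℕ → Pol
      Eᵢ₋₁ zero     = 0P
      Eᵢ₋₁ (suc i′) = scaleP (β ^ k) (substP (E n i′ k) αi)

module _ {c ℓ a ℓa} {F : Field c ℓ} (A : FAlgebra F a ℓa) where
  open FAlgebra A
  private module K = Field F

  mono : Carrier → Carrier → Carrier → ℕ → ℕ → ℕ → Carrier
  mono x y z i j k = (x ^ i) * (y ^ j) * (z ^ k)

  combo : Carrier → Carrier → Carrier → ℕ → (ℕ → ℕ → ℕ → K.Carrier) → Carrier
  combo x y z N f = Σ≤ N (λ i → Σ≤ N (λ j → Σ≤ N (λ k → ι (f i j k) * mono x y z i j k)))

  record IsPBWBasis (x y z : Carrier) : Set (a ⊔ ℓa ⊔ c ⊔ ℓ) where
    field
      spanning    : ∀ u → ∃ λ N → ∃ λ f → u ≈ combo x y z N f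
      independent : ∀ N f → combo x y z N f ≈ 0# →
                    ∀ i j k → i Data.Nat.≤ N → j Data.Nat.≤ N → k Data.Nat.≤ N →
                    f i j k K.≈ K.0#

-- Everything follows from three commutation rules: y x = α⁻¹ x y, z y = α⁻¹ y z,
-- and z xʳ = βʳ xʳ z + xʳ⁻¹ P_r(y), which holds by induction on r because
-- P_{r+1}(y) = P_r(α⁻¹ y) + βʳ (y + b).  Hence z xʳ and, more generally, a normal-form
-- term xⁱ f(y) zᵏ multiplied on the right by xⁿ yᵐ zᵗ can be brought back to normal form,
-- polynomials in y moving past x or z at the cost of the substitution y ↦ α⁻¹ y.
-- Collecting terms by the number ℓ of x's that were used up gives exactly the
-- recursions for W (from zⁿ xᵐ) and R; U and V are the cases m = 0 and n = m = t = 1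
-- of R, and E arises in the same way from (x + z)ⁿ⁺¹ = (x + z)ⁿ (x + z).
-- Uniqueness holds because distinct pairs of x- and z-exponents give distinct PBW
-- monomials.
module Submission where

open import Level using (Level; _⊔_)
open import Algebra.Bundles using (CommutativeMonoid)
import Algebra.Solver.Monoid as MonoidSolver
open import Data.Bool using (true; false; if_then_else_)
open import Data.Empty using (⊥-elim)
open import Data.Integer using (+_) renaming (_-_ to _-ℤ_; _*_ to _*ℤ_)
import Data.Integer.Properties as ℤ
open import Data.List using ([]; _∷_; length)
open import Data.Nat using (ℕ; zero; suc; _≤_; _<_; _∸_; _⊓_; _≤ᵇ_; z≤n; s≤s)
  renaming (_+_ to _+ℕ_; _*_ to _*ℕ_; _⊔_ to _⊔ℕ_)
open import Data.Nat.Combinatorics using (_C_; nCk+nC[k+1]≡[n+1]C[k+1]; nC1≡n)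
import Data.Nat.Properties as ℕ
open import Data.Nat.Solver using (module +-*-Solver)
open import Data.Product using (_×_; _,_; proj₁; proj₂; ∃)
open import Data.Sum using (inj₁; inj₂)
open import Data.Unit using (tt)
open import Relation.Binary.PropositionalEquality as ≡ using (_≡_; _≢_)
open import Relation.Nullary using (¬_; Dec; yes; no)
open import Defs

if-≤ᵇ-true : ∀ {ℓ} {X : Set ℓ} {m n} {p q : X} → m ≤ n → (if m ≤ᵇ n then p else q) ≡ p
if-≤ᵇ-true {m = m} {n} m≤n with m ≤ᵇ n | ℕ.≤⇒≤ᵇ m≤n
... | true | _ = ≡.refl

if-≤ᵇ-false : ∀ {ℓ} {X : Set ℓ} {m n} {p q : X} → n < m → (if m ≤ᵇ n then p else q) ≡ q
if-≤ᵇ-false {m = m} {n} n<m with m ≤ᵇ n | ℕ.≤ᵇ⇒≤ m n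
... | true  | m≤n = ⊥-elim (ℕ.<⇒≱ n<m (m≤n tt))
... | false | _   = ≡.refl

m⊓n<o⇒o≤m⇒n<o : ∀ {m n o} → m ⊓ n < o → o ≤ m → n < o
m⊓n<o⇒o≤m⇒n<o m⊓n<o o≤m = ℕ.≰⇒> (λ o≤n → ℕ.<⇒≱ m⊓n<o (ℕ.⊓-glb o≤m o≤n))

m∸n≡suc[m∸suc[n]] : ∀ {m n} → n < m → m ∸ n ≡ suc (m ∸ suc n)
m∸n≡suc[m∸suc[n]] {suc m} {zero}  _         = ≡.refl
m∸n≡suc[m∸suc[n]] {suc m} {suc n} (s≤s n<m) = m∸n≡suc[m∸suc[n]] n<m

m<n+o⇒n≤m⇒m∸n<o : ∀ {m n o} → m < n +ℕ o → n ≤ m → m ∸ n < o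
m<n+o⇒n≤m⇒m∸n<o {n = n} {o} m<n+o n≤m with ℕ.m≤n⇒∃[o]m+o≡n n≤m
... | d , ≡.refl = ≡.subst (_< o) (≡.sym (ℕ.m+n∸m≡n n d)) (ℕ.+-cancelˡ-< n d o m<n+o)

o≤n⇒n+m<l⇒m<l∸o : ∀ {l m n o} → o ≤ n → n +ℕ m < l → m < l ∸ o
o≤n⇒n+m<l⇒m<l∸o {l} {m} {n} {o} o≤n n+m<l = ℕ.+-cancelʳ-< o m (l ∸ o)
  (≡.subst (m +ℕ o <_) (≡.sym (ℕ.m∸n+n≡m o≤l)) (ℕ.≤-<-trans (ℕ.+-monoʳ-≤ m o≤n) (≡.subst (_< l) (ℕ.+-comm n m) n+m<l)))
  where
  o≤l : o ≤ l
  o≤l = ℕ.≤-trans o≤n (ℕ.≤-trans (ℕ.m≤m+n n m) (ℕ.<⇒≤ n+m<l))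

[m∸n]+[o∸p]≡[o+m]∸[n+p] : ∀ {m n o p} → n ≤ m → p ≤ o → (m ∸ n) +ℕ (o ∸ p) ≡ (o +ℕ m) ∸ (n +ℕ p)
[m∸n]+[o∸p]≡[o+m]∸[n+p] {n = n} {p = p} n≤m p≤o with ℕ.m≤n⇒∃[o]m+o≡n n≤m | ℕ.m≤n⇒∃[o]m+o≡n p≤o
... | d , ≡.refl | e , ≡.refl = begin
  (n +ℕ d ∸ n) +ℕ (p +ℕ e ∸ p)     ≡⟨ ≡.cong₂ _+ℕ_ (ℕ.m+n∸m≡n n d) (ℕ.m+n∸m≡n p e) ⟩
  d +ℕ e                           ≡⟨ ℕ.m+n∸m≡n (n +ℕ p) (d +ℕ e) ⟨
  (n +ℕ p) +ℕ (d +ℕ e) ∸ (n +ℕ p)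
    ≡⟨ ≡.cong (_∸ (n +ℕ p)) (solve 4 (λ n p d e → (n :+ p) :+ (d :+ e) := (p :+ e) :+ (n :+ d)) ≡.refl n p d e) ⟩
  (p +ℕ e) +ℕ (n +ℕ d) ∸ (n +ℕ p)  ∎
  where
  open +-*-Solver
  open ≡.≡-Reasoning

[m∸n∸p]+o≡[o+m]∸[n+p] : ∀ {m n o p} → n +ℕ p ≤ m → (m ∸ n ∸ p) +ℕ o ≡ (o +ℕ m) ∸ (n +ℕ p)
[m∸n∸p]+o≡[o+m]∸[n+p] {m} {n} {o} {p} n+p≤m = begin
  (m ∸ n ∸ p) +ℕ o        ≡⟨ ≡.cong (_+ℕ o) (ℕ.∸-+-assoc m n p) ⟩
  (m ∸ (n +ℕ p)) +ℕ o     ≡⟨ ℕ.+-comm _ o ⟩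
  o +ℕ (m ∸ (n +ℕ p))     ≡⟨ ℕ.+-∸-assoc o n+p≤m ⟨
  (o +ℕ m) ∸ (n +ℕ p)     ∎
  where open ≡.≡-Reasoning

[+m-+n]*+o≡+[[m∸n]*o] : ∀ {m n} o → n ≤ m → (+ m -ℤ + n) *ℤ + o ≡ + ((m ∸ n) *ℕ o)
[+m-+n]*+o≡+[[m∸n]*o] {m} {n} o n≤m =
  ≡.trans (≡.cong (_*ℤ + o) (≡.trans (ℤ.[+m]-[+n]≡m⊖n m n) (ℤ.⊖-≥ n≤m))) (≡.sym (ℤ.pos-* (m ∸ n) o))

C2-suc : ∀ m n s → m *ℕ n *ℕ (suc s C 2) ≡ m *ℕ n *ℕ (s C 2) +ℕ n *ℕ s *ℕ m
C2-suc m n s = begin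
  m *ℕ n *ℕ (suc s C 2)       ≡⟨ ≡.cong (m *ℕ n *ℕ_) (nCk+nC[k+1]≡[n+1]C[k+1] s 1) ⟨
  m *ℕ n *ℕ (s C 1 +ℕ s C 2)  ≡⟨ ≡.cong (λ t → m *ℕ n *ℕ (t +ℕ s C 2)) (nC1≡n s) ⟩
  m *ℕ n *ℕ (s +ℕ s C 2)      ≡⟨ solve 4 (λ m n s c → m :* n :* (s :+ c) := m :* n :* c :+ n :* s :* m) ≡.refl m n s (s C 2) ⟩
  m *ℕ n *ℕ (s C 2) +ℕ n *ℕ s *ℕ m ∎
  where
  open +-*-Solver
  open ≡.≡-Reasoning

upper-bound : ∀ K (h : ℕ → ℕ) → ∃ λ M → ∀ r → r ≤ K → h r ≤ M
upper-bound zero    h = h 0 , λ { zero z≤n → ℕ.≤-refl }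
upper-bound (suc K) h = M ⊔ℕ h (suc K) , h≤
  where
  M : ℕ
  M = proj₁ (upper-bound K h)
  h≤ : ∀ r → r ≤ suc K → h r ≤ M ⊔ℕ h (suc K)
  h≤ r r≤1+K with ℕ.m≤n⇒m<n∨m≡n r≤1+K
  ... | inj₁ r<1+K  = ℕ.m≤n⇒m≤n⊔o (h (suc K)) (proj₂ (upper-bound K h) r (ℕ.≤-pred r<1+K))
  ... | inj₂ ≡.refl = ℕ.m≤n⊔m M (h (suc K))

upper-bound₂ : ∀ K₁ (K₂ : ℕ → ℕ) (h : ℕ → ℕ → ℕ) → ∃ λ M → ∀ r s → r ≤ K₁ → s ≤ K₂ r → h r s ≤ M
upper-bound₂ K₁ K₂ h = proj₁ outer , λ r s r≤K₁ s≤K₂ →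
  ℕ.≤-trans (proj₂ (upper-bound (K₂ r) (h r)) s s≤K₂) (proj₂ outer r r≤K₁)
  where
  outer : ∃ λ M → ∀ r → r ≤ K₁ → proj₁ (upper-bound (K₂ r) (h r)) ≤ M
  outer = upper-bound K₁ (λ r → proj₁ (upper-bound (K₂ r) (h r)))

-- ∑ is a parameter so that the laws apply verbatim to the sums Σ≤ of Defs.
module SumLaws {c ℓ} (M : CommutativeMonoid c ℓ)
  (∑ : ℕ → (ℕ → CommutativeMonoid.Carrier M) → CommutativeMonoid.Carrier M)
  (∑-zero : ∀ f → CommutativeMonoid._≈_ M (∑ 0 f) (f 0))
  (∑-suc : ∀ n f → CommutativeMonoid._≈_ M (∑ (suc n) f) (CommutativeMonoid._∙_ M (∑ n f) (f (suc n))))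
  where

  open CommutativeMonoid M
  open import Algebra.Properties.CommutativeSemigroup commutativeSemigroup using (interchange)
  open import Relation.Binary.Reasoning.Setoid setoid

  ∑-cong : ∀ n {f g} → (∀ k → k ≤ n → f k ≈ g k) → ∑ n f ≈ ∑ n g
  ∑-cong zero {f} {g} f≈g = begin
    ∑ 0 f ≈⟨ ∑-zero f ⟩
    f 0   ≈⟨ f≈g 0 z≤n ⟩
    g 0   ≈⟨ ∑-zero g ⟨
    ∑ 0 g ∎
  ∑-cong (suc n) {f} {g} f≈g = begin
    ∑ (suc n) f       ≈⟨ ∑-suc n f ⟩
    ∑ n f ∙ f (suc n) ≈⟨ ∙-cong (∑-cong n (λ k k≤n → f≈g k (ℕ.m≤n⇒m≤1+n k≤n))) (f≈g (suc n) ℕ.≤-refl) ⟩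
    ∑ n g ∙ g (suc n) ≈⟨ ∑-suc n g ⟨
    ∑ (suc n) g       ∎

  ∑-ε : ∀ n {f} → (∀ k → k ≤ n → f k ≈ ε) → ∑ n f ≈ ε
  ∑-ε zero {f} f≈ε = trans (∑-zero f) (f≈ε 0 z≤n)
  ∑-ε (suc n) {f} f≈ε = begin
    ∑ (suc n) f       ≈⟨ ∑-suc n f ⟩
    ∑ n f ∙ f (suc n) ≈⟨ ∙-cong (∑-ε n (λ k k≤n → f≈ε k (ℕ.m≤n⇒m≤1+n k≤n))) (f≈ε (suc n) ℕ.≤-refl) ⟩
    ε ∙ ε             ≈⟨ identityˡ ε ⟩
    ε                 ∎

  ∑-distrib-∙ : ∀ n (f g : ℕ → Carrier) → ∑ n (λ k → f k ∙ g k) ≈ ∑ n f ∙ ∑ n g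
  ∑-distrib-∙ zero f g = begin
    ∑ 0 (λ k → f k ∙ g k) ≈⟨ ∑-zero _ ⟩
    f 0 ∙ g 0             ≈⟨ ∙-cong (∑-zero f) (∑-zero g) ⟨
    ∑ 0 f ∙ ∑ 0 g         ∎
  ∑-distrib-∙ (suc n) f g = begin
    ∑ (suc n) (λ k → f k ∙ g k)                     ≈⟨ ∑-suc n _ ⟩
    ∑ n (λ k → f k ∙ g k) ∙ (f (suc n) ∙ g (suc n)) ≈⟨ ∙-congʳ (∑-distrib-∙ n f g) ⟩
    (∑ n f ∙ ∑ n g) ∙ (f (suc n) ∙ g (suc n))       ≈⟨ interchange _ _ _ _ ⟩
    (∑ n f ∙ f (suc n)) ∙ (∑ n g ∙ g (suc n))       ≈⟨ ∙-cong (∑-suc n f) (∑-suc n g) ⟨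
    ∑ (suc n) f ∙ ∑ (suc n) g                       ∎

  ∑-head : ∀ n (f : ℕ → Carrier) → ∑ (suc n) f ≈ f 0 ∙ ∑ n (λ k → f (suc k))
  ∑-head zero f = begin
    ∑ 1 f       ≈⟨ ∑-suc 0 f ⟩
    ∑ 0 f ∙ f 1 ≈⟨ ∙-cong (∑-zero f) (sym (∑-zero _)) ⟩
    f 0 ∙ ∑ 0 (λ k → f (suc k)) ∎
  ∑-head (suc n) f = begin
    ∑ (suc (suc n)) f                                 ≈⟨ ∑-suc (suc n) f ⟩
    ∑ (suc n) f ∙ f (suc (suc n))                     ≈⟨ ∙-congʳ (∑-head n f) ⟩
    (f 0 ∙ ∑ n (λ k → f (suc k))) ∙ f (suc (suc n))   ≈⟨ assoc _ _ _ ⟩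
    f 0 ∙ (∑ n (λ k → f (suc k)) ∙ f (suc (suc n)))   ≈⟨ ∙-congˡ (∑-suc n _) ⟨
    f 0 ∙ ∑ (suc n) (λ k → f (suc k))                 ∎

  ∑-init : ∀ n f → f (suc n) ≈ ε → ∑ (suc n) f ≈ ∑ n f
  ∑-init n f last≈ε = trans (∑-suc n f) (trans (∙-congˡ last≈ε) (identityʳ _))

  ∑-tail : ∀ n f → f 0 ≈ ε → ∑ (suc n) f ≈ ∑ n (λ k → f (suc k))
  ∑-tail n f first≈ε = trans (∑-head n f) (trans (∙-congʳ first≈ε) (identityˡ _))

  ∑-stagger : ∀ m (f g h : ℕ → Carrier) → f 0 ≈ h 0 → (∀ k → k < m → f (suc k) ∙ g k ≈ h (suc k)) →
              g m ≈ ε → ∑ m (λ k → f k ∙ g k) ≈ ∑ m h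
  ∑-stagger zero f g h f0≈h0 _ g0≈ε = begin
    ∑ 0 (λ k → f k ∙ g k) ≈⟨ ∑-zero _ ⟩
    f 0 ∙ g 0             ≈⟨ ∙-cong f0≈h0 g0≈ε ⟩
    h 0 ∙ ε               ≈⟨ identityʳ _ ⟩
    h 0                   ≈⟨ ∑-zero h ⟨
    ∑ 0 h                 ∎
  ∑-stagger (suc m) f g h f0≈h0 step last≈ε = begin
    ∑ (suc m) (λ k → f k ∙ g k)                        ≈⟨ ∑-distrib-∙ (suc m) f g ⟩
    ∑ (suc m) f ∙ ∑ (suc m) g                          ≈⟨ ∙-cong (∑-head m f) (∑-init m g last≈ε) ⟩
    (f 0 ∙ ∑ m (λ k → f (suc k))) ∙ ∑ m g              ≈⟨ assoc _ _ _ ⟩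
    f 0 ∙ (∑ m (λ k → f (suc k)) ∙ ∑ m g)              ≈⟨ ∙-cong f0≈h0 (sym (∑-distrib-∙ m _ g)) ⟩
    h 0 ∙ ∑ m (λ k → f (suc k) ∙ g k)                  ≈⟨ ∙-congˡ (∑-cong m (λ k k≤m → step k (s≤s k≤m))) ⟩
    h 0 ∙ ∑ m (λ k → h (suc k))                        ≈⟨ ∑-head m h ⟨
    ∑ (suc m) h                                        ∎

  ∑-comm : ∀ n m (f : ℕ → ℕ → Carrier) → ∑ n (λ i → ∑ m (f i)) ≈ ∑ m (λ j → ∑ n (λ i → f i j))
  ∑-comm zero m f = trans (∑-zero _) (∑-cong m (λ j _ → sym (∑-zero _)))
  ∑-comm (suc n) m f = begin
    ∑ (suc n) (λ i → ∑ m (f i))                              ≈⟨ ∑-suc n _ ⟩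
    ∑ n (λ i → ∑ m (f i)) ∙ ∑ m (f (suc n))                  ≈⟨ ∙-congʳ (∑-comm n m f) ⟩
    ∑ m (λ j → ∑ n (λ i → f i j)) ∙ ∑ m (f (suc n))          ≈⟨ ∑-distrib-∙ m _ _ ⟨
    ∑ m (λ j → ∑ n (λ i → f i j) ∙ f (suc n) j)              ≈⟨ ∑-cong m (λ j _ → ∑-suc n _) ⟨
    ∑ m (λ j → ∑ (suc n) (λ i → f i j))                      ∎

  ∑∑-distrib-∙ : ∀ N M (f g : ℕ → ℕ → Carrier) →
                 ∑ N (λ i → ∑ M (λ k → f i k ∙ g i k)) ≈ ∑ N (λ i → ∑ M (f i)) ∙ ∑ N (λ i → ∑ M (g i))
  ∑∑-distrib-∙ N M f g = trans (∑-cong N (λ i _ → ∑-distrib-∙ M (f i) (g i))) (∑-distrib-∙ N _ _)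

  ∑-truncate : ∀ {K} N f → K ≤ N → (∀ k → K < k → k ≤ N → f k ≈ ε) → ∑ N f ≈ ∑ K f
  ∑-truncate zero f z≤n _ = refl
  ∑-truncate (suc N) f K≤1+N f≈ε with ℕ.m≤n⇒m<n∨m≡n K≤1+N
  ... | inj₂ ≡.refl = refl
  ... | inj₁ K<1+N = trans (∑-init N f (f≈ε (suc N) K<1+N ℕ.≤-refl))
    (∑-truncate N f (ℕ.≤-pred K<1+N) (λ k K<k k≤N → f≈ε k K<k (ℕ.m≤n⇒m≤1+n k≤N)))

  ∑-single : ∀ N a f → a ≤ N → (∀ k → k ≤ N → k ≢ a → f k ≈ ε) → ∑ N f ≈ f a
  ∑-single N a f a≤N f≈ε = begin
    ∑ N f ≈⟨ ∑-truncate N f a≤N (λ k a<k k≤N → f≈ε k k≤N (ℕ.>⇒≢ a<k)) ⟩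
    ∑ a f ≈⟨ up-to a (λ k k<a → f≈ε k (ℕ.≤-trans (ℕ.<⇒≤ k<a) a≤N) (ℕ.<⇒≢ k<a)) ⟩
    f a   ∎
    where
    up-to : ∀ a → (∀ k → k < a → f k ≈ ε) → ∑ a f ≈ f a
    up-to zero _ = ∑-zero f
    up-to (suc a) below≈ε =
      trans (∑-suc a f) (trans (∙-congʳ (∑-ε a (λ k k≤a → below≈ε k (s≤s k≤a)))) (identityˡ _))

  private
    -- Stands for the summand of index ℓ ∸ k, but is ε when ℓ < k instead of
    -- taking the junk value of truncated subtraction.
    guard : ℕ → ℕ → Carrier → Carrier
    guard zero    ℓ       v = v
    guard (suc k) zero    v = ε
    guard (suc k) (suc ℓ) v = guard k ℓ v

    guard-≤ : ∀ {k ℓ} v → k ≤ ℓ → guard k ℓ v ≡ v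
    guard-≤ v z≤n = ≡.refl
    guard-≤ v (s≤s k≤ℓ) = guard-≤ v k≤ℓ

    guard-> : ∀ {k ℓ} v → ℓ < k → guard k ℓ v ≡ ε
    guard-> {suc k} {zero} v _ = ≡.refl
    guard-> {suc k} {suc ℓ} v (s≤s ℓ<k) = guard-> v ℓ<k

    ∑-shift : ∀ B k n (h : ℕ → Carrier) → k ≤ n → (∀ a → B < a → h a ≈ ε) →
              ∑ (B +ℕ n) (λ ℓ → guard k ℓ (h (ℓ ∸ k))) ≈ ∑ B h
    ∑-shift B zero n h _ h≈ε = ∑-truncate (B +ℕ n) h (ℕ.m≤m+n B n) (λ a B<a _ → h≈ε a B<a)
    ∑-shift B (suc k) (suc n) h (s≤s k≤n) h≈ε = begin
      ∑ (B +ℕ suc n) (λ ℓ → guard (suc k) ℓ (h (ℓ ∸ suc k))) ≡⟨ ≡.cong (λ N → ∑ N (λ ℓ → guard (suc k) ℓ (h (ℓ ∸ suc k)))) (ℕ.+-suc B n) ⟩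
      ∑ (suc (B +ℕ n)) (λ ℓ → guard (suc k) ℓ (h (ℓ ∸ suc k))) ≈⟨ ∑-tail (B +ℕ n) _ refl ⟩
      ∑ (B +ℕ n) (λ ℓ → guard k ℓ (h (ℓ ∸ k)))                ≈⟨ ∑-shift B k n h k≤n h≈ε ⟩
      ∑ B h                                                    ∎

    ∑-guard : ∀ n ℓ (v : ℕ → Carrier) → ∑ n (λ k → guard k ℓ (v k)) ≈ ∑ (n ⊓ ℓ) v
    ∑-guard n ℓ v = begin
      ∑ n (λ k → guard k ℓ (v k))       ≈⟨ ∑-truncate n _ (ℕ.m⊓n≤m n ℓ) (λ k n⊓ℓ<k k≤n →
                                             reflexive (guard-> (v k) (m⊓n<o⇒o≤m⇒n<o n⊓ℓ<k k≤n))) ⟩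
      ∑ (n ⊓ ℓ) (λ k → guard k ℓ (v k)) ≈⟨ ∑-cong (n ⊓ ℓ) (λ k k≤n⊓ℓ →
                                             reflexive (guard-≤ (v k) (ℕ.≤-trans k≤n⊓ℓ (ℕ.m⊓n≤n n ℓ)))) ⟩
      ∑ (n ⊓ ℓ) v                       ∎

  ∑∑-antidiagonal : ∀ B n (g : ℕ → ℕ → Carrier) → (∀ a k → B < a → k ≤ n → g a k ≈ ε) →
    ∑ B (λ a → ∑ n (g a)) ≈ ∑ (B +ℕ n) (λ ℓ → ∑ (n ⊓ ℓ) (λ k → g (ℓ ∸ k) k))
  ∑∑-antidiagonal B n g g≈ε = begin
    ∑ B (λ a → ∑ n (g a))                                  ≈⟨ ∑-comm B n g ⟩
    ∑ n (λ k → ∑ B (λ a → g a k))                          ≈⟨ ∑-cong n (λ k k≤n →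
                                                                sym (∑-shift B k n (λ a → g a k) k≤n (λ a B<a → g≈ε a k B<a k≤n))) ⟩
    ∑ n (λ k → ∑ (B +ℕ n) (λ ℓ → guard k ℓ (g (ℓ ∸ k) k))) ≈⟨ ∑-comm n (B +ℕ n) _ ⟩
    ∑ (B +ℕ n) (λ ℓ → ∑ n (λ k → guard k ℓ (g (ℓ ∸ k) k))) ≈⟨ ∑-cong (B +ℕ n) (λ ℓ _ → ∑-guard n ℓ _) ⟩
    ∑ (B +ℕ n) (λ ℓ → ∑ (n ⊓ ℓ) (λ k → g (ℓ ∸ k) k))       ∎

module FamilyScalars {c ℓ} (F : Field c ℓ) (α αi β b : Field.Carrier F) where
  open Field F
  open Families F α αi β b
  open import Algebra.Properties.CommutativeSemigroup *-commutativeSemigroup using (x∙yz≈y∙xz)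
  open import Relation.Binary.Reasoning.Setoid setoid

  private
    Σ<-cong : ∀ r {f g} → (∀ j → f j ≈ g j) → Σ< r f ≈ Σ< r g
    Σ<-cong zero    f≈g = refl
    Σ<-cong (suc r) f≈g = +-cong (Σ<-cong r f≈g) (f≈g r)

    Σ<-head : ∀ r f → Σ< (suc r) f ≈ f 0 + Σ< r (λ j → f (suc j))
    Σ<-head zero    f = trans (+-identityˡ _) (sym (+-identityʳ _))
    Σ<-head (suc r) f = trans (+-congʳ (Σ<-head r f)) (+-assoc _ _ _)

    *-distribˡ-Σ< : ∀ q r f → q * Σ< r f ≈ Σ< r (λ j → q * f j)
    *-distribˡ-Σ< q zero    f = zeroʳ q
    *-distribˡ-Σ< q (suc r) f = trans (distribˡ _ _ _) (+-congʳ (*-distribˡ-Σ< q r f))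

  ⟨⟩-suc : ∀ r → ⟨ suc r ⟩ ≈ αi * ⟨ r ⟩ + β ^ r
  ⟨⟩-suc zero = begin
    0# + 1# * 1# ≈⟨ +-congˡ (*-identityˡ 1#) ⟩
    0# + 1#      ≈⟨ +-congʳ (zeroʳ αi) ⟨
    αi * 0# + 1# ∎
  ⟨⟩-suc (suc r) = begin
    ⟨ suc (suc r) ⟩                                                     ≈⟨ Σ<-head (suc r) _ ⟩
    β ^ suc r * 1# + Σ< (suc r) (λ j → β ^ (r ∸ j) * (αi * αi ^ j))
      ≈⟨ +-cong (*-identityʳ _) (Σ<-cong (suc r) (λ j → x∙yz≈y∙xz _ _ _)) ⟩
    β ^ suc r + Σ< (suc r) (λ j → αi * (β ^ (r ∸ j) * αi ^ j))          ≈⟨ +-congˡ (*-distribˡ-Σ< αi (suc r) _) ⟨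
    β ^ suc r + αi * ⟨ suc r ⟩                                          ≈⟨ +-comm _ _ ⟩
    αi * ⟨ suc r ⟩ + β ^ suc r                                          ∎

  qbin-0 : ∀ q n → qbin q n 0 ≡ 1#
  qbin-0 q zero    = ≡.refl
  qbin-0 q (suc n) = ≡.refl

  qbin-vanishes : ∀ q {n k} → n < k → qbin q n k ≈ 0#
  qbin-vanishes q {zero}  {suc k} _ = refl
  qbin-vanishes q {suc n} {suc k} (s≤s n<k) = begin
    qbin q n k + q ^ suc k * qbin q n (suc k) ≈⟨ +-cong (qbin-vanishes q n<k) (*-congˡ (qbin-vanishes q (ℕ.m≤n⇒m≤1+n n<k))) ⟩
    0# + q ^ suc k * 0#                       ≈⟨ +-identityˡ _ ⟩
    q ^ suc k * 0#                            ≈⟨ zeroʳ _ ⟩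
    0#                                        ∎

module AlgebraFacts {c ℓ a ℓa} (F : Field c ℓ) (A : FAlgebra F a ℓa) where
  open FAlgebra A
  module K = Field F
  open Poly F
  open import Algebra.Properties.Ring ring using (x+x≈x⇒x≈0; +-inverseˡ-unique; x∙y⁻¹≈ε⇒x≈y)
  open import Algebra.Properties.CommutativeSemigroup +-commutativeSemigroup using (interchange)
  open import Relation.Binary.Reasoning.Setoid setoid

  open SumLaws +-commutativeMonoid Σ≤ (λ _ → refl) (λ _ _ → refl) public

  ι-0 : ι K.0# ≈ 0#
  ι-0 = x+x≈x⇒x≈0 _ (trans (sym (ι-+ K.0# K.0#)) (ι-cong (K.+-identityʳ K.0#)))

  ι-neg : ∀ p → ι (K.- p) ≈ - ι p
  ι-neg p = +-inverseˡ-unique _ _ (trans (sym (ι-+ _ _)) (trans (ι-cong (K.-‿inverseˡ p)) ι-0))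

  ι-identityˡ : ∀ v → ι K.1# * v ≈ v
  ι-identityˡ v = trans (*-congʳ ι-1) (*-identityˡ v)

  ι-merge : ∀ p q v → ι p * (ι q * v) ≈ ι (p K.* q) * v
  ι-merge p q v = trans (sym (*-assoc _ _ _)) (*-congʳ (sym (ι-* p q)))

  ι-float : ∀ p u v → u * (ι p * v) ≈ ι p * (u * v)
  ι-float p u v = begin
    u * (ι p * v) ≈⟨ *-assoc _ _ _ ⟨
    (u * ι p) * v ≈⟨ *-congʳ (ι-central p u) ⟨
    (ι p * u) * v ≈⟨ *-assoc _ _ _ ⟩
    ι p * (u * v) ∎

  ^-cong : ∀ {u v} n → u ≈ v → u ^ n ≈ v ^ n
  ^-cong zero    u≈v = refl
  ^-cong (suc n) u≈v = *-cong u≈v (^-cong n u≈v)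

  ^-distribˡ-+-* : ∀ u m n → u ^ (m +ℕ n) ≈ u ^ m * u ^ n
  ^-distribˡ-+-* u zero    n = sym (*-identityˡ _)
  ^-distribˡ-+-* u (suc m) n = trans (*-congˡ (^-distribˡ-+-* u m n)) (sym (*-assoc _ _ _))

  ^-sucʳ : ∀ u n → u ^ suc n ≈ u ^ n * u
  ^-sucʳ u zero    = trans (*-identityʳ u) (sym (*-identityˡ u))
  ^-sucʳ u (suc n) = trans (*-congˡ (^-sucʳ u n)) (sym (*-assoc _ _ _))

  ι-^ : ∀ p n → ι (p K.^ n) ≈ ι p ^ n
  ι-^ p zero    = ι-1
  ι-^ p (suc n) = trans (ι-* _ _) (*-congˡ (ι-^ p n))

  ι-^-+ : ∀ q m n → ι (q K.^ (m +ℕ n)) ≈ ι (q K.^ m) * ι (q K.^ n)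
  ι-^-+ q m n = trans (ι-^ q (m +ℕ n)) (trans (^-distribˡ-+-* (ι q) m n) (sym (*-cong (ι-^ q m) (ι-^ q n))))

  x-y≈z⇒x≈y+z : ∀ {u v w} → u - v ≈ w → u ≈ v + w
  x-y≈z⇒x≈y+z {u} {v} {w} u-v≈w = begin
    u            ≈⟨ +-identityʳ u ⟨
    u + 0#       ≈⟨ +-congˡ (-‿inverseˡ v) ⟨
    u + (- v + v) ≈⟨ +-assoc _ _ _ ⟨
    (u - v) + v  ≈⟨ +-congʳ u-v≈w ⟩
    w + v        ≈⟨ +-comm w v ⟩
    v + w        ∎

  commutation-inverse : ∀ {q q⁻¹ u v} → q K.* q⁻¹ K.≈ K.1# → u - ι q * v ≈ 0# → v ≈ ι q⁻¹ * u
  commutation-inverse {q} {q⁻¹} {u} {v} q*q⁻¹≈1 u-qv≈0 = begin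
    v                    ≈⟨ ι-identityˡ v ⟨
    ι K.1# * v           ≈⟨ *-congʳ (ι-cong (K.trans (K.*-comm q⁻¹ q) q*q⁻¹≈1)) ⟨
    ι (q⁻¹ K.* q) * v    ≈⟨ ι-merge q⁻¹ q v ⟨
    ι q⁻¹ * (ι q * v)    ≈⟨ *-congˡ (x∙y⁻¹≈ε⇒x≈y u _ u-qv≈0) ⟨
    ι q⁻¹ * u            ∎

  *-distribˡ-Σ≤ : ∀ u n f → u * Σ≤ n f ≈ Σ≤ n (λ k → u * f k)
  *-distribˡ-Σ≤ u zero    f = refl
  *-distribˡ-Σ≤ u (suc n) f = trans (distribˡ _ _ _) (+-congʳ (*-distribˡ-Σ≤ u n f))

  *-distribʳ-Σ≤ : ∀ u n f → Σ≤ n f * u ≈ Σ≤ n (λ k → f k * u)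
  *-distribʳ-Σ≤ u zero    f = refl
  *-distribʳ-Σ≤ u (suc n) f = trans (distribʳ _ _ _) (+-congʳ (*-distribʳ-Σ≤ u n f))

  ev : Pol → Carrier → Carrier
  ev p u = evalP A p u

  ev-+P : ∀ p q u → ev (p +P q) u ≈ ev p u + ev q u
  ev-+P []      q       u = sym (+-identityˡ _)
  ev-+P (a ∷ p) []      u = sym (+-identityʳ _)
  ev-+P (a ∷ p) (b ∷ q) u = begin
    ι (a K.+ b) + u * ev (p +P q) u           ≈⟨ +-cong (ι-+ a b) (*-congˡ (ev-+P p q u)) ⟩
    (ι a + ι b) + u * (ev p u + ev q u)       ≈⟨ +-congˡ (distribˡ _ _ _) ⟩
    (ι a + ι b) + (u * ev p u + u * ev q u)   ≈⟨ interchange _ _ _ _ ⟩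
    (ι a + u * ev p u) + (ι b + u * ev q u)   ∎

  ev-scaleP : ∀ s p u → ev (scaleP s p) u ≈ ι s * ev p u
  ev-scaleP s []      u = sym (zeroʳ _)
  ev-scaleP s (b ∷ p) u = begin
    ι (s K.* b) + u * ev (scaleP s p) u ≈⟨ +-cong (ι-* s b) (*-congˡ (ev-scaleP s p u)) ⟩
    ι s * ι b + u * (ι s * ev p u)      ≈⟨ +-congˡ (ι-float s u _) ⟩
    ι s * ι b + ι s * (u * ev p u)      ≈⟨ distribˡ _ _ _ ⟨
    ι s * (ι b + u * ev p u)            ∎

  ev-*P : ∀ p q u → ev (p *P q) u ≈ ev p u * ev q u
  ev-*P []      q u = sym (zeroˡ _)
  ev-*P (a ∷ p) q u = begin
    ev (scaleP a q +P (K.0# ∷ (p *P q))) u              ≈⟨ ev-+P (scaleP a q) _ u ⟩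
    ev (scaleP a q) u + (ι K.0# + u * ev (p *P q) u)    ≈⟨ +-cong (ev-scaleP a q u) (+-cong ι-0 (*-congˡ (ev-*P p q u))) ⟩
    ι a * ev q u + (0# + u * (ev p u * ev q u))         ≈⟨ +-congˡ (trans (+-identityˡ _) (sym (*-assoc _ _ _))) ⟩
    ι a * ev q u + (u * ev p u) * ev q u                ≈⟨ distribʳ _ _ _ ⟨
    (ι a + u * ev p u) * ev q u                         ∎

  ev-cong : ∀ p {u v} → u ≈ v → ev p u ≈ ev p v
  ev-cong []      u≈v = refl
  ev-cong (b ∷ p) u≈v = +-congˡ (*-cong u≈v (ev-cong p u≈v))

  ev-substP : ∀ p s u → ev (substP p s) u ≈ ev p (ι s * u)
  ev-substP []      s u = refl
  ev-substP (b ∷ p) s u = +-congˡ (begin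
    u * ev (scaleP s (substP p s)) u    ≈⟨ *-congˡ (ev-scaleP s (substP p s) u) ⟩
    u * (ι s * ev (substP p s) u)       ≈⟨ *-assoc _ _ _ ⟨
    (u * ι s) * ev (substP p s) u       ≈⟨ *-cong (sym (ι-central s u)) (ev-substP p s u) ⟩
    (ι s * u) * ev p (ι s * u)          ∎)

  ev-substP-substP : ∀ p s t u → ev (substP (substP p s) t) u ≈ ev (substP p (s K.* t)) u
  ev-substP-substP p s t u = begin
    ev (substP (substP p s) t) u ≈⟨ ev-substP (substP p s) t u ⟩
    ev (substP p s) (ι t * u)    ≈⟨ ev-substP p s _ ⟩
    ev p (ι s * (ι t * u))       ≈⟨ ev-cong p (ι-merge s t u) ⟩
    ev p (ι (s K.* t) * u)       ≈⟨ ev-substP p _ u ⟨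
    ev (substP p (s K.* t)) u    ∎

  ev-substP-1 : ∀ p u → ev (substP p K.1#) u ≈ ev p u
  ev-substP-1 p u = trans (ev-substP p K.1# u) (ev-cong p (ι-identityˡ u))

  ev-yPow : ∀ m u → ev (yPow m) u ≈ u ^ m
  ev-yPow zero    u = trans (+-congˡ (zeroʳ u)) (trans (+-identityʳ _) ι-1)
  ev-yPow (suc m) u = trans (+-congʳ ι-0) (trans (+-identityˡ _) (*-congˡ (ev-yPow m u)))

  ev-1P : ∀ u → ev 1P u ≈ 1#
  ev-1P = ev-yPow 0

  ev-yP : ∀ u → ev yP u ≈ u
  ev-yP u = trans (ev-yPow 1 u) (*-identityʳ u)

  ev-ΣP≤ : ∀ n f u → ev (ΣP≤ n f) u ≈ Σ≤ n (λ k → ev (f k) u)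
  ev-ΣP≤ zero    f u = refl
  ev-ΣP≤ (suc n) f u = trans (ev-+P (ΣP≤ n f) (f (suc n)) u) (+-congʳ (ev-ΣP≤ n f u))

  ev-commuteˡ : ∀ p {w u v} → w * u ≈ v * w → w * ev p u ≈ ev p v * w
  ev-commuteˡ []      {w} _ = trans (zeroʳ w) (sym (zeroˡ w))
  ev-commuteˡ (b ∷ p) {w} {u} {v} wu≈vw = begin
    w * (ι b + u * ev p u)          ≈⟨ distribˡ _ _ _ ⟩
    w * ι b + w * (u * ev p u)      ≈⟨ +-cong (sym (ι-central b w)) (sym (*-assoc _ _ _)) ⟩
    ι b * w + (w * u) * ev p u      ≈⟨ +-congˡ (*-congʳ wu≈vw) ⟩
    ι b * w + (v * w) * ev p u      ≈⟨ +-congˡ (*-assoc _ _ _) ⟩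
    ι b * w + v * (w * ev p u)      ≈⟨ +-congˡ (*-congˡ (ev-commuteˡ p wu≈vw)) ⟩
    ι b * w + v * (ev p v * w)      ≈⟨ +-congˡ (*-assoc _ _ _) ⟨
    ι b * w + (v * ev p v) * w      ≈⟨ distribʳ _ _ _ ⟨
    (ι b + v * ev p v) * w          ∎

  ev-commuteʳ : ∀ p {w u v} → u * w ≈ w * v → ev p u * w ≈ w * ev p v
  ev-commuteʳ []      {w} _ = trans (zeroˡ w) (sym (zeroʳ w))
  ev-commuteʳ (b ∷ p) {w} {u} {v} uw≈wv = begin
    (ι b + u * ev p u) * w          ≈⟨ distribʳ _ _ _ ⟩
    ι b * w + (u * ev p u) * w      ≈⟨ +-cong (ι-central b w) (*-assoc _ _ _) ⟩
    w * ι b + u * (ev p u * w)      ≈⟨ +-congˡ (*-congˡ (ev-commuteʳ p uw≈wv)) ⟩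
    w * ι b + u * (w * ev p v)      ≈⟨ +-congˡ (*-assoc _ _ _) ⟨
    w * ι b + (u * w) * ev p v      ≈⟨ +-congˡ (*-congʳ uw≈wv) ⟩
    w * ι b + (w * v) * ev p v      ≈⟨ +-congˡ (*-assoc _ _ _) ⟩
    w * ι b + w * (v * ev p v)      ≈⟨ distribˡ _ _ _ ⟨
    w * (ι b + v * ev p v)          ∎

  ev-*-comm : ∀ p q u → ev p u * ev q u ≈ ev q u * ev p u
  ev-*-comm p q u = ev-commuteˡ q (sym (ev-commuteˡ p refl))

  -- A record, so that p can be inferred from a proof.
  record Vanishes (p : Pol) : Set (a ⊔ ℓa) where
    constructor mkVanishes
    field vanishes : ∀ u → ev p u ≈ 0#
  open Vanishes public

  []-vanishes : Vanishes []
  []-vanishes = mkVanishes (λ _ → refl)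

  +P-vanishes : ∀ {p q} → Vanishes p → Vanishes q → Vanishes (p +P q)
  +P-vanishes {p} {q} p≈0 q≈0 =
    mkVanishes (λ u → trans (ev-+P p q u) (trans (+-cong (vanishes p≈0 u) (vanishes q≈0 u)) (+-identityˡ 0#)))

  scaleP-vanishes : ∀ s {p} → Vanishes p → Vanishes (scaleP s p)
  scaleP-vanishes s {p} p≈0 = mkVanishes (λ u → trans (ev-scaleP s p u) (trans (*-congˡ (vanishes p≈0 u)) (zeroʳ _)))

  *P-vanishesˡ : ∀ {p} q → Vanishes p → Vanishes (p *P q)
  *P-vanishesˡ {p} q p≈0 = mkVanishes (λ u → trans (ev-*P p q u) (trans (*-congʳ (vanishes p≈0 u)) (zeroˡ _)))

  *P-vanishesʳ : ∀ p {q} → Vanishes q → Vanishes (p *P q)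
  *P-vanishesʳ p {q} q≈0 = mkVanishes (λ u → trans (ev-*P p q u) (trans (*-congˡ (vanishes q≈0 u)) (zeroʳ _)))

  substP-vanishes : ∀ {p} s → Vanishes p → Vanishes (substP p s)
  substP-vanishes {p} s p≈0 = mkVanishes (λ u → trans (ev-substP p s u) (vanishes p≈0 _))

  if-vanishes : ∀ bb {p q} → Vanishes p → Vanishes q → Vanishes (if bb then p else q)
  if-vanishes true  p≈0 _   = p≈0
  if-vanishes false _   q≈0 = q≈0

  ΣP≤-vanishes : ∀ n {f} → (∀ k → k ≤ n → Vanishes (f k)) → Vanishes (ΣP≤ n f)
  ΣP≤-vanishes n {f} f≈0 = mkVanishes (λ u → trans (ev-ΣP≤ n f u) (∑-ε n (λ k k≤n → vanishes (f≈0 k k≤n) u)))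

  module QCommuting {u w : Carrier} (q : K.Carrier) (w*u : w * u ≈ ι q * (u * w)) where

    ^-commuteʳ : ∀ m → w * u ^ m ≈ ι (q K.^ m) * (u ^ m * w)
    ^-commuteʳ zero = trans (*-identityʳ w) (sym (trans (ι-identityˡ _) (*-identityˡ w)))
    ^-commuteʳ (suc m) = begin
      w * (u * u ^ m)                               ≈⟨ *-assoc _ _ _ ⟨
      (w * u) * u ^ m                               ≈⟨ *-congʳ w*u ⟩
      (ι q * (u * w)) * u ^ m                       ≈⟨ trans (*-assoc _ _ _) (*-congˡ (*-assoc _ _ _)) ⟩
      ι q * (u * (w * u ^ m))                       ≈⟨ *-congˡ (*-congˡ (^-commuteʳ m)) ⟩
      ι q * (u * (ι (q K.^ m) * (u ^ m * w)))       ≈⟨ *-congˡ (ι-float _ _ _) ⟩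
      ι q * (ι (q K.^ m) * (u * (u ^ m * w)))       ≈⟨ ι-merge _ _ _ ⟩
      ι (q K.^ suc m) * (u * (u ^ m * w))           ≈⟨ *-congˡ (*-assoc _ _ _) ⟨
      ι (q K.^ suc m) * ((u * u ^ m) * w)           ∎

    ^-commute : ∀ m n → w ^ n * u ^ m ≈ ι (q K.^ (m *ℕ n)) * (u ^ m * w ^ n)
    ^-commute m zero = begin
      1# * u ^ m                          ≈⟨ *-identityˡ _ ⟩
      u ^ m                               ≈⟨ *-identityʳ _ ⟨
      u ^ m * 1#                          ≈⟨ ι-identityˡ _ ⟨
      ι K.1# * (u ^ m * 1#)               ≡⟨ ≡.cong (λ t → ι (q K.^ t) * (u ^ m * 1#)) (ℕ.*-zeroʳ m) ⟨
      ι (q K.^ (m *ℕ 0)) * (u ^ m * 1#)   ∎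
    ^-commute m (suc n) = begin
      (w * w ^ n) * u ^ m                                           ≈⟨ *-assoc _ _ _ ⟩
      w * (w ^ n * u ^ m)                                           ≈⟨ *-congˡ (^-commute m n) ⟩
      w * (ι (q K.^ (m *ℕ n)) * (u ^ m * w ^ n))                    ≈⟨ ι-float _ _ _ ⟩
      ι (q K.^ (m *ℕ n)) * (w * (u ^ m * w ^ n))                    ≈⟨ *-congˡ (*-assoc _ _ _) ⟨
      ι (q K.^ (m *ℕ n)) * ((w * u ^ m) * w ^ n)                    ≈⟨ *-congˡ (*-congʳ (^-commuteʳ m)) ⟩
      ι (q K.^ (m *ℕ n)) * ((ι (q K.^ m) * (u ^ m * w)) * w ^ n)    ≈⟨ *-congˡ (trans (*-assoc _ _ _) (*-congˡ (*-assoc _ _ _))) ⟩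
      ι (q K.^ (m *ℕ n)) * (ι (q K.^ m) * (u ^ m * (w * w ^ n)))    ≈⟨ ι-merge _ _ _ ⟩
      ι (q K.^ (m *ℕ n) K.* q K.^ m) * (u ^ m * (w * w ^ n))
        ≈⟨ *-congʳ (trans (ι-* _ _) (trans (ι-central _ _) (sym (ι-^-+ q m (m *ℕ n))))) ⟩
      ι (q K.^ (m +ℕ m *ℕ n)) * (u ^ m * (w * w ^ n))
        ≡⟨ ≡.cong (λ t → ι (q K.^ t) * (u ^ m * (w * w ^ n))) (ℕ.*-suc m n) ⟨
      ι (q K.^ (m *ℕ suc n)) * (u ^ m * (w * w ^ n))                ∎

    ^-of-product : ∀ m n s → (u ^ n * w ^ m) ^ s ≈ ι (q K.^ (m *ℕ n *ℕ (s C 2))) * (u ^ (n *ℕ s) * w ^ (m *ℕ s))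
    ^-of-product m n zero = begin
      1#                                                         ≈⟨ *-identityˡ 1# ⟨
      1# * 1#                                                    ≈⟨ ι-identityˡ _ ⟨
      ι K.1# * (1# * 1#)                                         ≡⟨ ≡.cong₂ (λ e v → ι (q K.^ e) * v) (ℕ.*-zeroʳ (m *ℕ n))
                                                                      (≡.cong₂ (λ i j → u ^ i * w ^ j) (ℕ.*-zeroʳ n) (ℕ.*-zeroʳ m)) ⟨
      ι (q K.^ (m *ℕ n *ℕ 0)) * (u ^ (n *ℕ 0) * w ^ (m *ℕ 0))   ∎
    ^-of-product m n (suc s) = begin
      (U * W) * (U * W) ^ s                                  ≈⟨ *-congˡ (^-of-product m n s) ⟩
      (U * W) * (ι e * (Us * Ws))                            ≈⟨ ι-float _ _ _ ⟩
      ι e * ((U * W) * (Us * Ws))                            ≈⟨ *-congˡ (trans (*-assoc _ _ _) (*-congˡ (sym (*-assoc _ _ _)))) ⟩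
      ι e * (U * ((W * Us) * Ws))                            ≈⟨ *-congˡ (*-congˡ (*-congʳ (^-commute (n *ℕ s) m))) ⟩
      ι e * (U * ((ι e′ * (Us * W)) * Ws))                    ≈⟨ *-congˡ (*-congˡ (*-assoc _ _ _)) ⟩
      ι e * (U * (ι e′ * ((Us * W) * Ws)))                    ≈⟨ *-congˡ (ι-float _ _ _) ⟩
      ι e * (ι e′ * (U * ((Us * W) * Ws)))                    ≈⟨ ι-merge _ _ _ ⟩
      ι (e K.* e′) * (U * ((Us * W) * Ws))
        ≈⟨ *-cong (trans (ι-* _ _) (sym (ι-^-+ q (m *ℕ n *ℕ (s C 2)) (n *ℕ s *ℕ m))))
           (trans (*-congˡ (*-assoc _ _ _)) (sym (*-assoc _ _ _))) ⟩
      ι (q K.^ (m *ℕ n *ℕ (s C 2) +ℕ n *ℕ s *ℕ m)) * ((U * Us) * (W * Ws))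
        ≈⟨ *-congˡ (*-cong (^-distribˡ-+-* u n (n *ℕ s)) (^-distribˡ-+-* w m (m *ℕ s))) ⟨
      ι (q K.^ (m *ℕ n *ℕ (s C 2) +ℕ n *ℕ s *ℕ m)) * (u ^ (n +ℕ n *ℕ s) * w ^ (m +ℕ m *ℕ s))
        ≡⟨ ≡.cong₂ (λ e v → ι (q K.^ e) * v) (C2-suc m n s)
             (≡.cong₂ (λ i j → u ^ i * w ^ j) (ℕ.*-suc n s) (ℕ.*-suc m s)) ⟨
      ι (q K.^ (m *ℕ n *ℕ (suc s C 2))) * (u ^ (n *ℕ suc s) * w ^ (m *ℕ suc s)) ∎
      where
      U W Us Ws : Carrier
      U  = u ^ n
      W  = w ^ m
      Us = u ^ (n *ℕ s)
      Ws = w ^ (m *ℕ s)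
      e e′ : K.Carrier
      e  = q K.^ (m *ℕ n *ℕ (s C 2))
      e′ = q K.^ (n *ℕ s *ℕ m)

module NormalTerms {c ℓ a ℓa} (F : Field c ℓ) (A : FAlgebra F a ℓa) (x z : FAlgebra.Carrier A) where
  open FAlgebra A

  term : ℕ → Carrier → ℕ → Carrier
  term i p k = x ^ i * p * z ^ k

  term-cong : ∀ i {p q} k → p ≈ q → term i p k ≈ term i q k
  term-cong i k p≈q = *-congʳ (*-congˡ p≈q)

  term-zero : ∀ i {p} k → p ≈ 0# → term i p k ≈ 0#
  term-zero i k p≈0 = trans (term-cong i k p≈0) (trans (*-congʳ (zeroʳ _)) (zeroˡ _))

  term-+ : ∀ i p q k → term i (p + q) k ≈ term i p k + term i q k
  term-+ i p q k = trans (*-congʳ (distribˡ _ _ _)) (distribʳ _ _ _)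

  term-Σ≤ : ∀ i n f k → Σ≤ n (λ j → term i (f j) k) ≈ term i (Σ≤ n f) k
  term-Σ≤ i zero    f k = refl
  term-Σ≤ i (suc n) f k = trans (+-congʳ (term-Σ≤ i n f k)) (sym (term-+ i _ _ k))

module FamiliesInA {c ℓ a ℓa} (F : Field c ℓ) (α αi β b : Field.Carrier F) (A : FAlgebra F a ℓa) where
  open FAlgebra A
  open AlgebraFacts F A
  open Poly F
  open Families F α αi β b
  open FamilyScalars F α αi β b
  open import Algebra.Properties.CommutativeSemigroup +-commutativeSemigroup using (interchange)
  open import Relation.Binary.Reasoning.Setoid setoid

  module _ {u w : Carrier} (q : K.Carrier) (w*u : w * u ≈ ι q * (u * w)) where
    open QCommuting q w*u using (^-commute)

    qterm : ℕ → ℕ → Carrier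
    qterm n k = ι (qbin q n k) * (u ^ (n ∸ k) * w ^ k)

    private
      w^*u : ∀ k → w ^ k * u ≈ ι (q K.^ k) * (u * w ^ k)
      w^*u k = begin
        w ^ k * u                         ≈⟨ *-congˡ (*-identityʳ u) ⟨
        w ^ k * u ^ 1                     ≈⟨ ^-commute 1 k ⟩
        ι (q K.^ (1 *ℕ k)) * (u ^ 1 * w ^ k) ≡⟨ ≡.cong (λ t → ι (q K.^ t) * (u ^ 1 * w ^ k)) (ℕ.*-identityˡ k) ⟩
        ι (q K.^ k) * (u ^ 1 * w ^ k)     ≈⟨ *-congˡ (*-congʳ (*-identityʳ u)) ⟩
        ι (q K.^ k) * (u * w ^ k)         ∎

      qterm*u : ∀ n k → k ≤ n → qterm n k * u ≈ ι (qbin q n k K.* q K.^ k) * (u ^ (suc n ∸ k) * w ^ k)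
      qterm*u n k k≤n = begin
        (ι (qbin q n k) * (u ^ (n ∸ k) * w ^ k)) * u               ≈⟨ trans (*-assoc _ _ _) (*-congˡ (*-assoc _ _ _)) ⟩
        ι (qbin q n k) * (u ^ (n ∸ k) * (w ^ k * u))               ≈⟨ *-congˡ (*-congˡ (w^*u k)) ⟩
        ι (qbin q n k) * (u ^ (n ∸ k) * (ι (q K.^ k) * (u * w ^ k))) ≈⟨ *-congˡ (ι-float _ _ _) ⟩
        ι (qbin q n k) * (ι (q K.^ k) * (u ^ (n ∸ k) * (u * w ^ k))) ≈⟨ ι-merge _ _ _ ⟩
        ι (qbin q n k K.* q K.^ k) * (u ^ (n ∸ k) * (u * w ^ k))
          ≈⟨ *-congˡ (trans (sym (*-assoc _ _ _)) (*-congʳ (sym (^-sucʳ u (n ∸ k))))) ⟩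
        ι (qbin q n k K.* q K.^ k) * (u ^ suc (n ∸ k) * w ^ k)
          ≡⟨ ≡.cong (λ t → ι (qbin q n k K.* q K.^ k) * (u ^ t * w ^ k)) (ℕ.+-∸-assoc 1 k≤n) ⟨
        ι (qbin q n k K.* q K.^ k) * (u ^ (suc n ∸ k) * w ^ k)     ∎

      qterm*w : ∀ n k → qterm n k * w ≈ ι (qbin q n k) * (u ^ (n ∸ k) * w ^ suc k)
      qterm*w n k = trans (*-assoc _ _ _) (*-congˡ (trans (*-assoc _ _ _) (*-congˡ (sym (^-sucʳ w k)))))

    q-binomial : ∀ n → (u + w) ^ n ≈ Σ≤ n (qterm n)
    q-binomial zero = sym (trans (ι-identityˡ _) (*-identityˡ 1#))
    q-binomial (suc n) = begin
      (u + w) * (u + w) ^ n                          ≈⟨ trans (^-sucʳ (u + w) n) (*-congʳ (q-binomial n)) ⟩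
      Σ≤ n (qterm n) * (u + w)                       ≈⟨ *-distribʳ-Σ≤ (u + w) n (qterm n) ⟩
      Σ≤ n (λ k → qterm n k * (u + w))
        ≈⟨ ∑-cong n (λ k k≤n → trans (distribˡ _ _ _) (+-cong (qterm*u n k k≤n) (qterm*w n k))) ⟩
      Σ≤ n (λ k → byU k + byW k)                     ≈⟨ ∑-distrib-∙ n byU byW ⟩
      Σ≤ n byU + Σ≤ n byW                            ≈⟨ +-congʳ (trans (sym (∑-init n byU byU-last≈0)) (∑-head n byU)) ⟩
      (byU 0 + Σ≤ n (λ k → byU (suc k))) + Σ≤ n byW  ≈⟨ trans (+-assoc _ _ _) (+-congˡ (+-comm _ _)) ⟩
      byU 0 + (Σ≤ n byW + Σ≤ n (λ k → byU (suc k)))  ≈⟨ +-cong byU0 (sym (∑-distrib-∙ n byW (λ k → byU (suc k)))) ⟩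
      qterm (suc n) 0 + Σ≤ n (λ k → byW k + byU (suc k)) ≈⟨ +-congˡ (∑-cong n (λ k _ → sym (pascal k))) ⟩
      qterm (suc n) 0 + Σ≤ n (λ k → qterm (suc n) (suc k)) ≈⟨ ∑-head n (qterm (suc n)) ⟨
      Σ≤ (suc n) (qterm (suc n))                     ∎
      where
      byU byW : ℕ → Carrier
      byU k = ι (qbin q n k K.* q K.^ k) * (u ^ (suc n ∸ k) * w ^ k)
      byW k = ι (qbin q n k) * (u ^ (n ∸ k) * w ^ suc k)
      byU-last≈0 : byU (suc n) ≈ 0#
      byU-last≈0 = trans (*-congʳ (trans (ι-cong (K.trans (K.*-congʳ (qbin-vanishes q {n} ℕ.≤-refl)) (K.zeroˡ _))) ι-0)) (zeroˡ _)
      byU0 : byU 0 ≈ qterm (suc n) 0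
      byU0 = *-congʳ (ι-cong (K.trans (K.*-identityʳ _) (K.reflexive (qbin-0 q n))))
      pascal : ∀ k → qterm (suc n) (suc k) ≈ byW k + byU (suc k)
      pascal k = trans (*-congʳ (ι-+ _ _)) (trans (distribʳ _ _ _) (+-congˡ (*-congʳ (ι-cong (K.*-comm _ _)))))

  ev-P : ∀ r u → ev (P r) u ≈ ι (b K.* [ r ] β) + ι ⟨ r ⟩ * u
  ev-P r u = begin
    ev (P r) u                                           ≈⟨ ev-+P ((b K.* [ r ] β) ∷ []) (scaleP ⟨ r ⟩ yP) u ⟩
    (ι (b K.* [ r ] β) + u * 0#) + ev (scaleP ⟨ r ⟩ yP) u ≈⟨ +-cong (trans (+-congˡ (zeroʳ u)) (+-identityʳ _))
                                                              (trans (ev-scaleP ⟨ r ⟩ yP u) (*-congˡ (ev-yP u))) ⟩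
    ι (b K.* [ r ] β) + ι ⟨ r ⟩ * u                      ∎

  ev-P-0 : ∀ u → ev (P 0) u ≈ 0#
  ev-P-0 u = trans (ev-P 0 u) (trans (+-cong (trans (ι-cong (K.zeroʳ b)) ι-0) (trans (*-congʳ ι-0) (zeroˡ u))) (+-identityʳ 0#))

  ev-P-suc : ∀ r u → ev (P (suc r)) u ≈ ev (P r) (ι αi * u) + ι (β K.^ r) * (u + ι b)
  ev-P-suc r u = begin
    ev (P (suc r)) u                                                  ≈⟨ ev-P (suc r) u ⟩
    ι (b K.* ([ r ] β K.+ β K.^ r)) + ι ⟨ suc r ⟩ * u                 ≈⟨ +-cong (trans (ι-cong (K.distribˡ b _ _)) (ι-+ _ _))
                                                                           (*-congʳ (trans (ι-cong (⟨⟩-suc r)) (ι-+ _ _))) ⟩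
    (ι (b K.* [ r ] β) + ι (b K.* β K.^ r)) + (ι (αi K.* ⟨ r ⟩) + ι (β K.^ r)) * u
      ≈⟨ +-congˡ (distribʳ _ _ _) ⟩
    (ι (b K.* [ r ] β) + ι (b K.* β K.^ r)) + (ι (αi K.* ⟨ r ⟩) * u + ι (β K.^ r) * u)
      ≈⟨ interchange _ _ _ _ ⟩
    (ι (b K.* [ r ] β) + ι (αi K.* ⟨ r ⟩) * u) + (ι (b K.* β K.^ r) + ι (β K.^ r) * u)
      ≈⟨ +-cong (+-congˡ αi-inside) (trans (+-comm _ _) (+-congˡ b-last)) ⟩
    (ι (b K.* [ r ] β) + ι ⟨ r ⟩ * (ι αi * u)) + (ι (β K.^ r) * u + ι (β K.^ r) * ι b)
      ≈⟨ +-cong (sym (ev-P r _)) (sym (distribˡ _ _ _)) ⟩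
    ev (P r) (ι αi * u) + ι (β K.^ r) * (u + ι b)                     ∎
    where
    αi-inside : ι (αi K.* ⟨ r ⟩) * u ≈ ι ⟨ r ⟩ * (ι αi * u)
    αi-inside = trans (*-congʳ (ι-cong (K.*-comm _ _))) (sym (ι-merge _ _ _))
    b-last : ι (b K.* β K.^ r) ≈ ι (β K.^ r) * ι b
    b-last = trans (ι-cong (K.*-comm _ _)) (ι-* _ _)

  ev-P-1 : ∀ u → ev (P 1) u ≈ u + ι b
  ev-P-1 u = trans (ev-P-suc 0 u) (trans (+-cong (ev-P-0 _) (ι-identityˡ _)) (+-identityˡ _))

  W-vanishes : ∀ m {n k} → n < k → Vanishes (W m n k)
  W-vanishes m {zero}  {suc k} _ = []-vanishes
  W-vanishes m {suc n} {suc k} (s≤s n<k) = if-vanishes (suc k ≤ᵇ m)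
    (+P-vanishes (scaleP-vanishes _ (substP-vanishes αi (W-vanishes m (ℕ.m≤n⇒m≤1+n n<k))))
                 (*P-vanishesʳ (P (suc (m ∸ suc k))) (W-vanishes m n<k)))
    []-vanishes

  ev-W-suc-suc : ∀ m n k u → suc k ≤ m → ev (W m (suc n) (suc k)) u
    ≈ ι (β K.^ (m ∸ suc k)) * ev (substP (W m n (suc k)) αi) u + ev (P (suc (m ∸ suc k))) u * ev (W m n k) u
  ev-W-suc-suc m n k u k<m = begin
    ev (W m (suc n) (suc k)) u                                     ≡⟨ ≡.cong (λ p → ev p u) (if-≤ᵇ-true k<m) ⟩
    ev (scaleP (β K.^ (m ∸ suc k)) (substP (W m n (suc k)) αi)
          +P P (suc (m ∸ suc k)) *P W m n k) u
            ≈⟨ ev-+P (scaleP (β K.^ (m ∸ suc k)) (substP (W m n (suc k)) αi)) (P (suc (m ∸ suc k)) *P W m n k) u ⟩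
    ev (scaleP (β K.^ (m ∸ suc k)) (substP (W m n (suc k)) αi)) u
      + ev (P (suc (m ∸ suc k)) *P W m n k) u
        ≈⟨ +-cong (ev-scaleP (β K.^ (m ∸ suc k)) (substP (W m n (suc k)) αi) u) (ev-*P (P (suc (m ∸ suc k))) (W m n k) u) ⟩
    ι (β K.^ (m ∸ suc k)) * ev (substP (W m n (suc k)) αi) u
      + ev (P (suc (m ∸ suc k))) u * ev (W m n k) u                ∎

  W⁻-vanishes : ∀ n N d k → N < d +ℕ k → Vanishes (W⁻ n N d k)
  W⁻-vanishes n N d k N<d+k with d ℕ.≤? N
  ... | yes d≤N = ≡.subst Vanishes (≡.sym (if-≤ᵇ-true {p = W n (N ∸ d) k} {q = 0P} d≤N))
                    (W-vanishes n (m<n+o⇒n≤m⇒m∸n<o N<d+k d≤N))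
  ... | no d≰N  = ≡.subst Vanishes (≡.sym (if-≤ᵇ-false {p = W n (N ∸ d) k} {q = 0P} (ℕ.≰⇒> d≰N))) []-vanishes

  module RFamily (n m t : ℕ) where

    -- The k-th summand of R n m t (suc S) L, scalar included, with its index L ∸ k
    -- generalised to ℓ.
    R-summand : ℕ → ℕ → ℕ → ℕ → Pol
    R-summand S L ℓ k = scaleP (α^- ((+ (t *ℕ S) -ℤ + L) *ℤ + m))
                          (yPow m *P (substP (R n m t S ℓ) (αi K.^ (n ∸ k)) *P W⁻ n (t *ℕ S) ℓ k))

    R-vanishes-x : ∀ s ℓ → n *ℕ suc s < ℓ → Vanishes (R n m t (suc s) ℓ)
    R-vanishes-x zero (suc ℓ) _ = []-vanishes
    R-vanishes-x (suc s) ℓ ns<ℓ =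
      scaleP-vanishes _ (*P-vanishesʳ (yPow m) (ΣP≤-vanishes (n ⊓ ℓ) (λ k k≤n⊓ℓ →
        *P-vanishesˡ (W⁻ n (t *ℕ suc s) (ℓ ∸ k) k) (substP-vanishes (αi K.^ (n ∸ k))
          (R-vanishes-x s (ℓ ∸ k) (o≤n⇒n+m<l⇒m<l∸o (ℕ.≤-trans k≤n⊓ℓ (ℕ.m⊓n≤m n ℓ))
                                    (≡.subst (_< ℓ) (ℕ.*-suc n (suc s)) ns<ℓ)))))))

    R-vanishes-z : ∀ s ℓ → t *ℕ suc s < ℓ → Vanishes (R n m t (suc s) ℓ)
    R-vanishes-z zero (suc ℓ) _ = []-vanishes
    R-vanishes-z (suc s) ℓ ts<ℓ =
      scaleP-vanishes _ (*P-vanishesʳ (yPow m) (ΣP≤-vanishes (n ⊓ ℓ) (λ k k≤n⊓ℓ →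
        *P-vanishesʳ (substP (R n m t (suc s) (ℓ ∸ k)) (αi K.^ (n ∸ k)))
          (W⁻-vanishes n (t *ℕ suc s) (ℓ ∸ k) k
            (≡.subst (t *ℕ suc s <_) (≡.sym (ℕ.m∸n+n≡m (ℕ.≤-trans k≤n⊓ℓ (ℕ.m⊓n≤n n ℓ)))) ts′<ℓ)))))
      where
      ts′<ℓ : t *ℕ suc s < ℓ
      ts′<ℓ = ℕ.≤-<-trans (ℕ.m≤n+m (t *ℕ suc s) t) (≡.subst (_< ℓ) (ℕ.*-suc t (suc s)) ts<ℓ)

    ev-R-suc : ∀ S L u → ev (R n m t (suc (suc S)) L) u ≈ Σ≤ (n ⊓ L) (λ k → ev (R-summand (suc S) L (L ∸ k) k) u)
    ev-R-suc S L u = begin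
      ev (scaleP κ (yPow m *P ΣP≤ (n ⊓ L) f)) u        ≈⟨ ev-scaleP κ (yPow m *P ΣP≤ (n ⊓ L) f) u ⟩
      ι κ * ev (yPow m *P ΣP≤ (n ⊓ L) f) u             ≈⟨ *-congˡ (trans (ev-*P (yPow m) _ u) (*-congˡ (ev-ΣP≤ (n ⊓ L) f u))) ⟩
      ι κ * (ev (yPow m) u * Σ≤ (n ⊓ L) (λ k → ev (f k) u)) ≈⟨ *-congˡ (*-distribˡ-Σ≤ _ (n ⊓ L) _) ⟩
      ι κ * Σ≤ (n ⊓ L) (λ k → ev (yPow m) u * ev (f k) u)   ≈⟨ *-distribˡ-Σ≤ (ι κ) (n ⊓ L) _ ⟩
      Σ≤ (n ⊓ L) (λ k → ι κ * (ev (yPow m) u * ev (f k) u)) ≈⟨ ∑-cong (n ⊓ L) (λ k _ →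
                                                                sym (trans (ev-scaleP κ (yPow m *P f k) u) (*-congˡ (ev-*P (yPow m) (f k) u)))) ⟩
      Σ≤ (n ⊓ L) (λ k → ev (R-summand (suc S) L (L ∸ k) k) u) ∎
      where
      κ : K.Carrier
      κ = α^- ((+ (t *ℕ suc S) -ℤ + L) *ℤ + m)
      f : ℕ → Pol
      f k = substP (R n m t (suc S) (L ∸ k)) (αi K.^ (n ∸ k)) *P W⁻ n (t *ℕ suc S) (L ∸ k) k

  ev-U≈ev-R : ∀ n m s ℓ u → ev (U n m s ℓ) u ≈ ev (R n 0 m s ℓ) u
  ev-U≈ev-R n m zero          zero    u = refl
  ev-U≈ev-R n m zero          (suc ℓ) u = refl
  ev-U≈ev-R n m (suc zero)    zero    u = refl
  ev-U≈ev-R n m (suc zero)    (suc ℓ) u = refl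
  ev-U≈ev-R n m (suc (suc s)) ℓ       u = begin
    ev (ΣP≤ (n ⊓ ℓ) fU) u                         ≈⟨ ev-ΣP≤ (n ⊓ ℓ) fU u ⟩
    Σ≤ (n ⊓ ℓ) (λ k → ev (fU k) u)                ≈⟨ ∑-cong (n ⊓ ℓ) (λ k _ → summand (ev-U≈ev-R n m (suc s)) k) ⟩
    Σ≤ (n ⊓ ℓ) (λ k → ev (fR k) u)                ≈⟨ ev-ΣP≤ (n ⊓ ℓ) fR u ⟨
    ev (ΣP≤ (n ⊓ ℓ) fR) u                         ≈⟨ trans (*-congʳ (ev-1P u)) (*-identityˡ _) ⟨
    ev (yPow 0) u * ev (ΣP≤ (n ⊓ ℓ) fR) u         ≈⟨ trans (ι-identityˡ _) (ev-*P (yPow 0) (ΣP≤ (n ⊓ ℓ) fR) u) ⟨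
    ι K.1# * ev (yPow 0 *P ΣP≤ (n ⊓ ℓ) fR) u      ≡⟨ ≡.cong (λ e → ι (α^- e) * ev (yPow 0 *P ΣP≤ (n ⊓ ℓ) fR) u)
                                                       (ℤ.*-zeroʳ (+ (m *ℕ suc s) -ℤ + ℓ)) ⟨
    ι (α^- ((+ (m *ℕ suc s) -ℤ + ℓ) *ℤ + 0)) * ev (yPow 0 *P ΣP≤ (n ⊓ ℓ) fR) u
      ≈⟨ ev-scaleP _ (yPow 0 *P ΣP≤ (n ⊓ ℓ) fR) u ⟨
    ev (R n 0 m (suc (suc s)) ℓ) u                ∎
    where
    fU fR : ℕ → Pol
    fU k = substP (U n m (suc s) (ℓ ∸ k)) (αi K.^ (n ∸ k)) *P W⁻ n (m *ℕ suc s) (ℓ ∸ k) k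
    fR k = substP (R n 0 m (suc s) (ℓ ∸ k)) (αi K.^ (n ∸ k)) *P W⁻ n (m *ℕ suc s) (ℓ ∸ k) k
    summand : (∀ ℓ′ u′ → ev (U n m (suc s) ℓ′) u′ ≈ ev (R n 0 m (suc s) ℓ′) u′) → ∀ k → ev (fU k) u ≈ ev (fR k) u
    summand IH k = begin
      ev (substP Uₖ κ *P w) u       ≈⟨ ev-*P (substP Uₖ κ) w u ⟩
      ev (substP Uₖ κ) u * ev w u   ≈⟨ *-congʳ (trans (ev-substP Uₖ κ u) (trans (IH (ℓ ∸ k) _) (sym (ev-substP Rₖ κ u)))) ⟩
      ev (substP Rₖ κ) u * ev w u   ≈⟨ ev-*P (substP Rₖ κ) w u ⟨
      ev (substP Rₖ κ *P w) u       ∎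
      where
      Uₖ Rₖ w : Pol
      Uₖ = U n m (suc s) (ℓ ∸ k)
      Rₖ = R n 0 m (suc s) (ℓ ∸ k)
      w  = W⁻ n (m *ℕ suc s) (ℓ ∸ k) k
      κ : K.Carrier
      κ = αi K.^ (n ∸ k)

  ev-W-1-0 : ∀ N u → ev (W 1 N 0) u ≈ ι (β K.^ N)
  ev-W-1-0 zero    u = trans (ev-1P u) (sym ι-1)
  ev-W-1-0 (suc N) u = begin
    ev (scaleP (β K.^ 1) (substP (W 1 N 0) αi)) u  ≈⟨ ev-scaleP (β K.^ 1) (substP (W 1 N 0) αi) u ⟩
    ι (β K.^ 1) * ev (substP (W 1 N 0) αi) u       ≈⟨ *-congˡ (trans (ev-substP (W 1 N 0) αi u) (ev-W-1-0 N _)) ⟩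
    ι (β K.^ 1) * ι (β K.^ N)                      ≈⟨ ι-* _ _ ⟨
    ι (β K.^ 1 K.* β K.^ N)                        ≈⟨ ι-cong (K.*-congʳ (K.*-identityʳ β)) ⟩
    ι (β K.^ suc N)                                ∎

  ev-W-1-1 : ∀ N u → ev (W 1 N 1) u ≈ ev (P N) u
  ev-W-1-1 zero    u = sym (ev-P-0 u)
  ev-W-1-1 (suc N) u = begin
    ev (scaleP (β K.^ 0) (substP (W 1 N 1) αi) +P P 1 *P W 1 N 0) u
      ≈⟨ ev-+P (scaleP (β K.^ 0) (substP (W 1 N 1) αi)) (P 1 *P W 1 N 0) u ⟩
    ev (scaleP (β K.^ 0) (substP (W 1 N 1) αi)) u + ev (P 1 *P W 1 N 0) u ≈⟨ +-cong (trans (ev-scaleP _ (substP (W 1 N 1) αi) u)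
                                                                                (trans (ι-identityˡ _) (trans (ev-substP (W 1 N 1) αi u) (ev-W-1-1 N _))))
                                                                               (trans (ev-*P (P 1) (W 1 N 0) u) (*-cong (ev-P-1 u) (ev-W-1-0 N u))) ⟩
    ev (P N) (ι αi * u) + (u + ι b) * ι (β K.^ N)                         ≈⟨ +-congˡ (ι-central _ _) ⟨
    ev (P N) (ι αi * u) + ι (β K.^ N) * (u + ι b)                         ≈⟨ ev-P-suc N u ⟨
    ev (P (suc N)) u                                                      ∎

  private
    ev-scaleP-yP : ∀ κ q u → ev (scaleP κ (yP *P q)) u ≈ ι κ * (u * ev q u)
    ev-scaleP-yP κ q u = trans (ev-scaleP κ (yP *P q) u) (*-congˡ (trans (ev-*P yP q u) (*-congʳ (ev-yP u))))

    α^-[1*S] : ∀ S L → α^- ((+ (1 *ℕ S) -ℤ + L) *ℤ + 1) ≡ α^- (+ S -ℤ + L)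
    α^-[1*S] S L = ≡.cong α^-_ (≡.trans (ℤ.*-identityʳ _) (≡.cong (λ j → + j -ℤ + L) (ℕ.*-identityˡ S)))

    module VStep (s : ℕ) (IH : ∀ ℓ u → ev (V (suc s) ℓ) u ≈ ev (R 1 1 1 (suc s) ℓ) u) where
      open RFamily 1 1 1 using (R-vanishes-x)

      S : ℕ
      S = suc s

      1*S≡S : 1 *ℕ S ≡ S
      1*S≡S = ℕ.*-identityˡ S

      ev-substP-V : ∀ ℓ u → ev (substP (V S ℓ) αi) u ≈ ev (substP (R 1 1 1 S ℓ) (αi K.^ 1)) u
      ev-substP-V ℓ u = begin
        ev (substP (V S ℓ) αi) u                ≈⟨ ev-substP (V S ℓ) αi u ⟩
        ev (V S ℓ) (ι αi * u)                   ≈⟨ IH ℓ _ ⟩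
        ev (R 1 1 1 S ℓ) (ι αi * u)             ≈⟨ ev-cong (R 1 1 1 S ℓ) (*-congʳ (ι-cong (K.*-identityʳ αi))) ⟨
        ev (R 1 1 1 S ℓ) (ι (αi K.^ 1) * u)     ≈⟨ ev-substP (R 1 1 1 S ℓ) (αi K.^ 1) u ⟨
        ev (substP (R 1 1 1 S ℓ) (αi K.^ 1)) u  ∎

      zeroth : ∀ u → ev (V (suc S) 0) u ≈ ev (R 1 1 1 (suc S) 0) u
      zeroth u = begin
        ev (V (suc S) 0) u                              ≈⟨ ev-scaleP-yP (α^- (+ S)) (scaleP (β K.^ S) V₀) u ⟩
        ι (α^- (+ S)) * (u * ev (scaleP (β K.^ S) V₀) u) ≈⟨ *-cong (reflexive (≡.cong ι scalar≡))
                                                             (*-congˡ (trans (ev-scaleP (β K.^ S) V₀ u) (ι-central _ _))) ⟩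
        ι cR * (u * (ev V₀ u * ι (β K.^ S)))            ≈⟨ *-congˡ (*-congˡ (*-cong (ev-substP-V 0 u) (sym W₀≈βˢ))) ⟩
        ι cR * (u * (ev R₀ u * ev W₀ u))                ≈⟨ *-congˡ (*-congˡ (ev-*P R₀ W₀ u)) ⟨
        ι cR * (u * ev (R₀ *P W₀) u)                    ≈⟨ ev-scaleP-yP cR (R₀ *P W₀) u ⟨
        ev (R 1 1 1 (suc S) 0) u                        ∎
        where
        V₀ R₀ W₀ : Pol
        V₀ = substP (V S 0) αi
        R₀ = substP (R 1 1 1 S 0) (αi K.^ 1)
        W₀ = W 1 (1 *ℕ S) 0
        cR : K.Carrier
        cR = α^- ((+ (1 *ℕ S) -ℤ + 0) *ℤ + 1)
        scalar≡ : α^- (+ S) ≡ cR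
        scalar≡ = ≡.sym (≡.trans (α^-[1*S] S 0) (≡.cong α^-_ (ℤ.+-identityʳ (+ S))))
        W₀≈βˢ : ev W₀ u ≈ ι (β K.^ S)
        W₀≈βˢ = trans (ev-W-1-0 (1 *ℕ S) u) (reflexive (≡.cong (λ j → ι (β K.^ j)) 1*S≡S))

      βpart : ∀ ℓ u → ev (scaleP (β K.^ (S ∸ suc ℓ)) (substP (V S (suc ℓ)) αi)) u
                      ≈ ev (substP (R 1 1 1 S (suc ℓ)) (αi K.^ 1) *P W⁻ 1 (1 *ℕ S) (suc ℓ) 0) u
      βpart ℓ u with suc ℓ ℕ.≤? S
      ... | yes ℓ<S = begin
        ev (scaleP (β K.^ (S ∸ suc ℓ)) Vℓ) u         ≈⟨ trans (ev-scaleP _ Vℓ u) (ι-central _ _) ⟩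
        ev Vℓ u * ι (β K.^ (S ∸ suc ℓ))              ≈⟨ *-cong (ev-substP-V (suc ℓ) u) (sym Wℓ≈β) ⟩
        ev Rℓ u * ev (W 1 (1 *ℕ S ∸ suc ℓ) 0) u
          ≡⟨ ≡.cong (λ q → ev Rℓ u * ev q u) (if-≤ᵇ-true (≡.subst (suc ℓ ≤_) (≡.sym 1*S≡S) ℓ<S)) ⟨
        ev Rℓ u * ev (W⁻ 1 (1 *ℕ S) (suc ℓ) 0) u     ≈⟨ ev-*P Rℓ (W⁻ 1 (1 *ℕ S) (suc ℓ) 0) u ⟨
        ev (Rℓ *P W⁻ 1 (1 *ℕ S) (suc ℓ) 0) u         ∎
        where
        Vℓ Rℓ : Pol
        Vℓ = substP (V S (suc ℓ)) αi
        Rℓ = substP (R 1 1 1 S (suc ℓ)) (αi K.^ 1)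
        Wℓ≈β : ev (W 1 (1 *ℕ S ∸ suc ℓ) 0) u ≈ ι (β K.^ (S ∸ suc ℓ))
        Wℓ≈β = trans (ev-W-1-0 (1 *ℕ S ∸ suc ℓ) u) (reflexive (≡.cong (λ j → ι (β K.^ (j ∸ suc ℓ))) 1*S≡S))
      ... | no ℓ≮S = trans (vanishes (scaleP-vanishes _ (substP-vanishes αi V≈0)) u)
                           (sym (vanishes (*P-vanishesˡ (W⁻ 1 (1 *ℕ S) (suc ℓ) 0) (substP-vanishes (αi K.^ 1) R≈0)) u))
        where
        R≈0 : Vanishes (R 1 1 1 S (suc ℓ))
        R≈0 = R-vanishes-x s (suc ℓ) (≡.subst (_< suc ℓ) (≡.sym 1*S≡S) (ℕ.≰⇒> ℓ≮S))
        V≈0 : Vanishes (V S (suc ℓ))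
        V≈0 = mkVanishes (λ u′ → trans (IH (suc ℓ) u′) (vanishes R≈0 u′))

      Ppart : ∀ ℓ u → ℓ ≤ S → ev (P (S ∸ ℓ) *P V S ℓ) u ≈ ev (substP (R 1 1 1 S ℓ) (αi K.^ 0) *P W⁻ 1 (1 *ℕ S) ℓ 1) u
      Ppart ℓ u ℓ≤S = begin
        ev (P (S ∸ ℓ) *P V S ℓ) u               ≈⟨ trans (ev-*P (P (S ∸ ℓ)) (V S ℓ) u) (ev-*-comm (P (S ∸ ℓ)) (V S ℓ) u) ⟩
        ev (V S ℓ) u * ev (P (S ∸ ℓ)) u          ≈⟨ *-cong (trans (IH ℓ u) (sym (ev-substP-1 (R 1 1 1 S ℓ) u))) (sym Wℓ≈P) ⟩
        ev Rℓ u * ev (W 1 (1 *ℕ S ∸ ℓ) 1) u      ≡⟨ ≡.cong (λ q → ev Rℓ u * ev q u) (if-≤ᵇ-true (≡.subst (ℓ ≤_) (≡.sym 1*S≡S) ℓ≤S)) ⟨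
        ev Rℓ u * ev (W⁻ 1 (1 *ℕ S) ℓ 1) u       ≈⟨ ev-*P Rℓ (W⁻ 1 (1 *ℕ S) ℓ 1) u ⟨
        ev (Rℓ *P W⁻ 1 (1 *ℕ S) ℓ 1) u           ∎
        where
        Rℓ : Pol
        Rℓ = substP (R 1 1 1 S ℓ) (αi K.^ 0)
        Wℓ≈P : ev (W 1 (1 *ℕ S ∸ ℓ) 1) u ≈ ev (P (S ∸ ℓ)) u
        Wℓ≈P = trans (ev-W-1-1 (1 *ℕ S ∸ ℓ) u) (reflexive (≡.cong (λ j → ev (P (j ∸ ℓ)) u) 1*S≡S))

      later : ∀ ℓ u → ev (V (suc S) (suc ℓ)) u ≈ ev (R 1 1 1 (suc S) (suc ℓ)) u
      later ℓ u with suc ℓ ℕ.≤? suc S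
      ... | yes (s≤s ℓ≤S) = begin
        ev (V (suc S) (suc ℓ)) u                       ≡⟨ ≡.cong (λ q → ev q u) (if-≤ᵇ-true {q = 0P} (s≤s ℓ≤S)) ⟩
        ev (scaleP cV (yP *P (βP +P PP))) u            ≈⟨ ev-scaleP-yP cV (βP +P PP) u ⟩
        ι cV * (u * ev (βP +P PP) u)                   ≈⟨ *-cong (reflexive (≡.cong ι (≡.sym (α^-[1*S] S (suc ℓ)))))
                                                           (*-congˡ (trans (ev-+P βP PP u) (+-cong (βpart ℓ u) (Ppart ℓ u ℓ≤S)))) ⟩
        ι cR * (u * (ev f₀ u + ev f₁ u))               ≈⟨ *-congˡ (*-congˡ (ev-+P f₀ f₁ u)) ⟨
        ι cR * (u * ev (f₀ +P f₁) u)                   ≈⟨ ev-scaleP-yP cR (f₀ +P f₁) u ⟨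
        ev (R 1 1 1 (suc S) (suc ℓ)) u                 ∎
        where
        cV cR : K.Carrier
        cV = α^- (+ S -ℤ + suc ℓ)
        cR = α^- ((+ (1 *ℕ S) -ℤ + suc ℓ) *ℤ + 1)
        βP PP f₀ f₁ : Pol
        βP = scaleP (β K.^ (S ∸ suc ℓ)) (substP (V S (suc ℓ)) αi)
        PP = P (S ∸ ℓ) *P V S ℓ
        f₀ = substP (R 1 1 1 S (suc ℓ)) (αi K.^ 1) *P W⁻ 1 (1 *ℕ S) (suc ℓ) 0
        f₁ = substP (R 1 1 1 S ℓ) (αi K.^ 0) *P W⁻ 1 (1 *ℕ S) ℓ 1
      ... | no ℓ≮S = trans (reflexive (≡.cong (λ q → ev q u) (if-≤ᵇ-false {q = 0P} (ℕ.≰⇒> ℓ≮S))))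
        (sym (vanishes (R-vanishes-x S (suc ℓ) (≡.subst (_< suc ℓ) (≡.sym (ℕ.*-identityˡ (suc S))) (ℕ.≰⇒> ℓ≮S))) u))

  ev-V≈ev-R : ∀ s ℓ u → ev (V s ℓ) u ≈ ev (R 1 1 1 s ℓ) u
  ev-V≈ev-R zero          zero    u = refl
  ev-V≈ev-R zero          (suc ℓ) u = refl
  ev-V≈ev-R (suc zero)    zero    u = refl
  ev-V≈ev-R (suc zero)    (suc ℓ) u = refl
  ev-V≈ev-R (suc (suc s)) zero    u = VStep.zeroth s (ev-V≈ev-R (suc s)) u
  ev-V≈ev-R (suc (suc s)) (suc ℓ) u = VStep.later s (ev-V≈ev-R (suc s)) ℓ u

  Eₖ₋₁ Eᵢ₋₁ : ℕ → ℕ → ℕ → Pol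
  Eₖ₋₁ n i zero    = 0P
  Eₖ₋₁ n i (suc k) = E n i k
  Eᵢ₋₁ n zero    k = 0P
  Eᵢ₋₁ n (suc i) k = scaleP (β K.^ k) (substP (E n i k) αi)

  E-vanishes : ∀ n i k → n < i +ℕ k → Vanishes (E n i k)
  E-vanishes zero    zero    (suc k) _ = []-vanishes
  E-vanishes zero    (suc i) k       _ = []-vanishes
  E-vanishes (suc n) i       k       n<i+k = ≡.subst Vanishes (≡.sym (if-≤ᵇ-false n<i+k)) []-vanishes

  private
    E-suc : ∀ n i k → i +ℕ k ≤ suc n → E (suc n) i k ≡ Eₖ₋₁ n i k +P Eᵢ₋₁ n i k +P P (suc k) *P E n i (suc k)
    E-suc n zero    zero    i+k≤n = if-≤ᵇ-true {q = 0P} i+k≤n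
    E-suc n zero    (suc k) i+k≤n = if-≤ᵇ-true {q = 0P} i+k≤n
    E-suc n (suc i) zero    i+k≤n = if-≤ᵇ-true {q = 0P} i+k≤n
    E-suc n (suc i) (suc k) i+k≤n = if-≤ᵇ-true {q = 0P} i+k≤n

  ev-E-suc : ∀ n i k u → ev (E (suc n) i k) u ≈ ev (Eₖ₋₁ n i k) u + ev (Eᵢ₋₁ n i k) u + ev (P (suc k) *P E n i (suc k)) u
  ev-E-suc n i k u with i +ℕ k ℕ.≤? suc n
  ... | yes i+k≤n = trans (reflexive (≡.cong (λ q → ev q u) (E-suc n i k i+k≤n)))
                          (trans (ev-+P (Eₖ₋₁ n i k +P Eᵢ₋₁ n i k) _ u) (+-congʳ (ev-+P (Eₖ₋₁ n i k) (Eᵢ₋₁ n i k) u)))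
  ... | no i+k≰n = begin
    ev (E (suc n) i k) u                                  ≈⟨ vanishes (E-vanishes (suc n) i k n<i+k) u ⟩
    0#                                                    ≈⟨ trans (+-identityʳ _) (+-identityʳ _) ⟨
    0# + 0# + 0#                                          ≈⟨ +-cong (+-cong (k-part i k n<i+k) (i-part i k n<i+k))
                                                               (vanishes (*P-vanishesʳ (P (suc k)) (E-vanishes n i (suc k) n<i+1+k)) u) ⟨
    ev (Eₖ₋₁ n i k) u + ev (Eᵢ₋₁ n i k) u + ev (P (suc k) *P E n i (suc k)) u ∎
    where
    n<i+k : suc n < i +ℕ k
    n<i+k = ℕ.≰⇒> i+k≰n
    n<i+1+k : n < i +ℕ suc k
    n<i+1+k = ≡.subst (n <_) (≡.sym (ℕ.+-suc i k)) (ℕ.m≤n⇒m≤1+n (ℕ.<⇒≤ n<i+k))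
    k-part : ∀ i k → suc n < i +ℕ k → ev (Eₖ₋₁ n i k) u ≈ 0#
    k-part i zero    _ = refl
    k-part i (suc k) lt = vanishes (E-vanishes n i k (ℕ.≤-pred (≡.subst (suc n <_) (ℕ.+-suc i k) lt))) u
    i-part : ∀ i k → suc n < i +ℕ k → ev (Eᵢ₋₁ n i k) u ≈ 0#
    i-part zero    k _ = refl
    i-part (suc i) k (s≤s lt) = vanishes (scaleP-vanishes (β K.^ k) (substP-vanishes αi (E-vanishes n i k lt))) u

module NormalOrdering {c ℓ a ℓa} (F : Field c ℓ) (α αi β b : Field.Carrier F) (A : FAlgebra F a ℓa) where
  open FAlgebra A

  module Expansions (x y z : Carrier)
    (y*x : y * x ≈ ι αi * (x * y))
    (z*y : z * y ≈ ι αi * (y * z))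
    (z*x : z * x ≈ ι β * (x * z) + (y + ι b))
    where

    open AlgebraFacts F A
    open Poly F
    open Families F α αi β b
    open FamiliesInA F α αi β b A
    open NormalTerms F A x z
    open import Relation.Binary.Reasoning.Setoid setoid
    open MonoidSolver *-monoid using (solve; _⊕_; _⊜_) renaming (id to one)

    z*ev : ∀ p → z * ev p y ≈ ev (substP p αi) y * z
    z*ev p = trans (ev-commuteˡ p (trans z*y (sym (*-assoc _ _ _)))) (*-congʳ (sym (ev-substP p αi y)))

    ev*x : ∀ p → ev p y * x ≈ x * ev (substP p αi) y
    ev*x p = trans (ev-commuteʳ p (trans y*x (sym (ι-float _ _ _)))) (*-congˡ (sym (ev-substP p αi y)))

    ev*x^ : ∀ p r → ev p y * x ^ r ≈ x ^ r * ev (substP p (αi K.^ r)) y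
    ev*x^ p zero = trans (*-identityʳ _) (sym (trans (*-identityˡ _) (ev-substP-1 p y)))
    ev*x^ p (suc r) = begin
      ev p y * (x * x ^ r)                                  ≈⟨ *-assoc _ _ _ ⟨
      (ev p y * x) * x ^ r                                  ≈⟨ *-congʳ (ev*x p) ⟩
      (x * ev (substP p αi) y) * x ^ r                      ≈⟨ *-assoc _ _ _ ⟩
      x * (ev (substP p αi) y * x ^ r)                      ≈⟨ *-congˡ (ev*x^ (substP p αi) r) ⟩
      x * (x ^ r * ev (substP (substP p αi) (αi K.^ r)) y)  ≈⟨ *-congˡ (*-congˡ (ev-substP-substP p αi (αi K.^ r) y)) ⟩
      x * (x ^ r * ev (substP p (αi K.^ suc r)) y)          ≈⟨ *-assoc _ _ _ ⟨
      (x * x ^ r) * ev (substP p (αi K.^ suc r)) y          ∎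

    private
      -- x ^ (r ∸ 1) * x ≈ x ^ r fails for r = 0, but there P 0 = 0.
      x^pred*x : ∀ r v → x ^ (r ∸ 1) * (x * ev (P r) v) ≈ x ^ r * ev (P r) v
      x^pred*x zero v = begin
        1# * (x * ev (P 0) v) ≈⟨ *-congˡ (trans (*-congˡ (ev-P-0 v)) (zeroʳ x)) ⟩
        1# * 0#               ≈⟨ *-congˡ (ev-P-0 v) ⟨
        1# * ev (P 0) v       ∎
      x^pred*x (suc r) v = trans (sym (*-assoc _ _ _)) (*-congʳ (sym (^-sucʳ x r)))

    z*x^ : ∀ r → z * x ^ r ≈ ι (β K.^ r) * (x ^ r * z) + x ^ (r ∸ 1) * ev (P r) y
    z*x^ zero = begin
      z * 1#                                       ≈⟨ trans (*-identityʳ z) (sym (trans (ι-identityˡ _) (*-identityˡ z))) ⟩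
      ι K.1# * (1# * z)                            ≈⟨ +-identityʳ _ ⟨
      ι K.1# * (1# * z) + 0#                       ≈⟨ +-congˡ (trans (*-congˡ (ev-P-0 y)) (zeroʳ _)) ⟨
      ι K.1# * (1# * z) + 1# * ev (P 0) y          ∎
    z*x^ (suc r) = begin
      z * (x * x ^ r)                                                    ≈⟨ trans (*-congˡ (^-sucʳ x r)) (sym (*-assoc _ _ _)) ⟩
      (z * x ^ r) * x                                                    ≈⟨ *-congʳ (z*x^ r) ⟩
      (ι (β K.^ r) * (x ^ r * z) + x ^ (r ∸ 1) * ev (P r) y) * x         ≈⟨ distribʳ _ _ _ ⟩
      (ι (β K.^ r) * (x ^ r * z)) * x + (x ^ (r ∸ 1) * ev (P r) y) * x   ≈⟨ trans (+-cong z-part P-part) (+-assoc _ _ _) ⟩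
      ι (β K.^ suc r) * ((x * x ^ r) * z)
        + (x ^ r * (ι (β K.^ r) * (y + ι b)) + x ^ r * ev (P r) (ι αi * y)) ≈⟨ +-congˡ (trans (sym (distribˡ _ _ _))
                                                                              (*-congˡ (trans (+-comm _ _) (sym (ev-P-suc r y))))) ⟩
      ι (β K.^ suc r) * ((x * x ^ r) * z) + x ^ r * ev (P (suc r)) y     ∎
      where
      z-part : (ι (β K.^ r) * (x ^ r * z)) * x ≈ ι (β K.^ suc r) * ((x * x ^ r) * z) + x ^ r * (ι (β K.^ r) * (y + ι b))
      z-part = begin
        (ι (β K.^ r) * (x ^ r * z)) * x                                   ≈⟨ trans (*-assoc _ _ _) (*-congˡ (*-assoc _ _ _)) ⟩
        ι (β K.^ r) * (x ^ r * (z * x))                                   ≈⟨ *-congˡ (*-congˡ z*x) ⟩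
        ι (β K.^ r) * (x ^ r * (ι β * (x * z) + (y + ι b)))               ≈⟨ trans (*-congˡ (distribˡ _ _ _)) (distribˡ _ _ _) ⟩
        ι (β K.^ r) * (x ^ r * (ι β * (x * z))) + ι (β K.^ r) * (x ^ r * (y + ι b))
          ≈⟨ +-cong (*-congˡ (ι-float _ _ _)) (sym (ι-float _ _ _)) ⟩
        ι (β K.^ r) * (ι β * (x ^ r * (x * z))) + x ^ r * (ι (β K.^ r) * (y + ι b))
          ≈⟨ +-congʳ (ι-merge _ _ _) ⟩
        ι (β K.^ r K.* β) * (x ^ r * (x * z)) + x ^ r * (ι (β K.^ r) * (y + ι b))
          ≈⟨ +-congʳ (*-cong (ι-cong (K.*-comm _ _))
               (trans (sym (*-assoc _ _ _)) (*-congʳ (sym (^-sucʳ x r))))) ⟩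
        ι (β K.^ suc r) * ((x * x ^ r) * z) + x ^ r * (ι (β K.^ r) * (y + ι b)) ∎
      P-part : (x ^ (r ∸ 1) * ev (P r) y) * x ≈ x ^ r * ev (P r) (ι αi * y)
      P-part = trans (*-assoc _ _ _) (trans (*-congˡ (ev-commuteʳ (P r) (trans y*x (sym (ι-float _ _ _))))) (x^pred*x r _))

    z*term : ∀ i q k → z * term i (ev q y) k
             ≈ term i (ι (β K.^ i) * ev (substP q αi) y) (suc k) + term (i ∸ 1) (ev (P i) y * ev q y) k
    z*term i q k = begin
      z * ((x ^ i * ev q y) * z ^ k)
        ≈⟨ trans (sym (*-assoc _ _ _)) (*-congʳ (sym (*-assoc _ _ _))) ⟩
      ((z * x ^ i) * ev q y) * z ^ k                                          ≈⟨ *-congʳ (*-congʳ (z*x^ i)) ⟩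
      ((ι (β K.^ i) * (x ^ i * z) + x ^ (i ∸ 1) * ev (P i) y) * ev q y) * z ^ k ≈⟨ trans (*-congʳ (distribʳ _ _ _)) (distribʳ _ _ _) ⟩
      ((ι (β K.^ i) * (x ^ i * z)) * ev q y) * z ^ k
        + ((x ^ (i ∸ 1) * ev (P i) y) * ev q y) * z ^ k                       ≈⟨ +-cong z-past-q (*-congʳ (*-assoc _ _ _)) ⟩
      term i (ι (β K.^ i) * ev (substP q αi) y) (suc k) + term (i ∸ 1) (ev (P i) y * ev q y) k ∎
      where
      z-past-q : ((ι (β K.^ i) * (x ^ i * z)) * ev q y) * z ^ k ≈ term i (ι (β K.^ i) * ev (substP q αi) y) (suc k)
      z-past-q = begin
        ((ι (β K.^ i) * (x ^ i * z)) * ev q y) * z ^ k        ≈⟨ *-congʳ (trans (*-assoc _ _ _) (*-congˡ (*-assoc _ _ _))) ⟩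
        (ι (β K.^ i) * (x ^ i * (z * ev q y))) * z ^ k        ≈⟨ *-congʳ (*-congˡ (*-congˡ (z*ev q))) ⟩
        (ι (β K.^ i) * (x ^ i * (ev (substP q αi) y * z))) * z ^ k ≈⟨ *-congʳ (sym (ι-float _ _ _)) ⟩
        (x ^ i * (ι (β K.^ i) * (ev (substP q αi) y * z))) * z ^ k ≈⟨ *-congʳ (trans (*-congˡ (sym (*-assoc _ _ _))) (sym (*-assoc _ _ _))) ⟩
        ((x ^ i * (ι (β K.^ i) * ev (substP q αi) y)) * z) * z ^ k ≈⟨ *-assoc _ _ _ ⟩
        term i (ι (β K.^ i) * ev (substP q αi) y) (suc k)     ∎

    private
      W-suc-term : ∀ m n k → k < m →
        term (m ∸ suc k) (ι (β K.^ (m ∸ suc k)) * ev (substP (W m n (suc k)) αi) y) (suc (n ∸ suc k))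
          + term (m ∸ k ∸ 1) (ev (P (m ∸ k)) y * ev (W m n k) y) (n ∸ k)
        ≈ term (m ∸ suc k) (ev (W m (suc n) (suc k)) y) (n ∸ k)
      W-suc-term m n k k<m = begin
        term (m ∸ suc k) βpart (suc (n ∸ suc k)) + term (m ∸ k ∸ 1) (ev (P (m ∸ k)) y * ev (W m n k) y) (n ∸ k)
          ≈⟨ +-cong βpart-shift (reflexive (≡.cong (λ t → term (t ∸ 1) (ev (P t) y * ev (W m n k) y) (n ∸ k))
             (m∸n≡suc[m∸suc[n]] k<m))) ⟩
        term (m ∸ suc k) βpart (n ∸ k) + term (m ∸ suc k) (ev (P (suc (m ∸ suc k))) y * ev (W m n k) y) (n ∸ k)
          ≈⟨ term-+ (m ∸ suc k) βpart (ev (P (suc (m ∸ suc k))) y * ev (W m n k) y) (n ∸ k) ⟨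
        term (m ∸ suc k) (βpart + ev (P (suc (m ∸ suc k))) y * ev (W m n k) y) (n ∸ k)
          ≈⟨ term-cong (m ∸ suc k) (n ∸ k) (ev-W-suc-suc m n k y k<m) ⟨
        term (m ∸ suc k) (ev (W m (suc n) (suc k)) y) (n ∸ k) ∎
        where
        βpart : Carrier
        βpart = ι (β K.^ (m ∸ suc k)) * ev (substP (W m n (suc k)) αi) y
        βpart-shift : term (m ∸ suc k) βpart (suc (n ∸ suc k)) ≈ term (m ∸ suc k) βpart (n ∸ k)
        βpart-shift with suc k ℕ.≤? n
        ... | yes k<n = reflexive (≡.cong (term (m ∸ suc k) βpart) (≡.sym (m∸n≡suc[m∸suc[n]] k<n)))
        ... | no k≮n = trans (term-zero (m ∸ suc k) (suc (n ∸ suc k)) βpart≈0) (sym (term-zero (m ∸ suc k) (n ∸ k) βpart≈0))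
          where
          βpart≈0 : βpart ≈ 0#
          βpart≈0 = trans (*-congˡ (vanishes (substP-vanishes αi (W-vanishes m (ℕ.≰⇒> k≮n))) y)) (zeroʳ _)

    z^*x^-wide : ∀ m n → z ^ n * x ^ m ≈ Σ≤ m (λ k → term (m ∸ k) (ev (W m n k) y) (n ∸ k))
    z^*x^-wide m zero = begin
      1# * x ^ m                                          ≈⟨ trans (*-identityˡ _) (sym (trans (*-identityʳ _) (*-identityʳ _))) ⟩
      (x ^ m * 1#) * 1#                                   ≈⟨ term-cong m 0 (ev-1P y) ⟨
      term m (ev (W m 0 0) y) 0                           ≈⟨ ∑-single m 0 _ z≤n higher≈0 ⟨
      Σ≤ m (λ k → term (m ∸ k) (ev (W m 0 k) y) (0 ∸ k))  ∎
      where
      higher≈0 : ∀ k → k ≤ m → k ≢ 0 → term (m ∸ k) (ev (W m 0 k) y) (0 ∸ k) ≈ 0#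
      higher≈0 zero    _ k≢0 = ⊥-elim (k≢0 ≡.refl)
      higher≈0 (suc k) _ _   = term-zero (m ∸ suc k) 0 refl
    z^*x^-wide m (suc n) = begin
      (z * z ^ n) * x ^ m                                          ≈⟨ trans (*-assoc _ _ _) (*-congˡ (z^*x^-wide m n)) ⟩
      z * Σ≤ m (λ k → term (m ∸ k) (ev (W m n k) y) (n ∸ k))       ≈⟨ *-distribˡ-Σ≤ z m _ ⟩
      Σ≤ m (λ k → z * term (m ∸ k) (ev (W m n k) y) (n ∸ k))       ≈⟨ ∑-cong m (λ k _ → z*term (m ∸ k) (W m n k) (n ∸ k)) ⟩
      Σ≤ m (λ k → sameK k + lowerK k)                              ≈⟨ ∑-stagger m sameK lowerK _ first (λ k → W-suc-term m n k) last ⟩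
      Σ≤ m (λ k → term (m ∸ k) (ev (W m (suc n) k) y) (suc n ∸ k)) ∎
      where
      sameK lowerK : ℕ → Carrier
      sameK k  = term (m ∸ k) (ι (β K.^ (m ∸ k)) * ev (substP (W m n k) αi) y) (suc (n ∸ k))
      lowerK k = term (m ∸ k ∸ 1) (ev (P (m ∸ k)) y * ev (W m n k) y) (n ∸ k)
      first : sameK 0 ≈ term m (ev (W m (suc n) 0) y) (suc n)
      first = term-cong m (suc n) (sym (ev-scaleP (β K.^ m) (substP (W m n 0) αi) y))
      last : lowerK m ≈ 0#
      last = term-zero (m ∸ m ∸ 1) (n ∸ m)
        (trans (*-congʳ (≡.subst (λ t → ev (P t) y ≈ 0#) (≡.sym (ℕ.n∸n≡0 m)) (ev-P-0 y))) (zeroˡ _))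

    z^*x^ : ∀ m n → z ^ n * x ^ m ≈ Σ≤ (m ⊓ n) (λ k → x ^ (m ∸ k) * ev (W m n k) y * z ^ (n ∸ k))
    z^*x^ m n = trans (z^*x^-wide m n) (∑-truncate m _ (ℕ.m⊓n≤m m n) (λ k m⊓n<k k≤m →
      term-zero (m ∸ k) (n ∸ k) (vanishes (W-vanishes m (m⊓n<o⇒o≤m⇒n<o m⊓n<k k≤m)) y)))

    private
      y^*ev : ∀ m q → y ^ m * ev q y ≈ ev q y * y ^ m
      y^*ev m q = ev-commuteˡ q (sym (^-sucʳ y m))

    x^ev*term*y^*z^ : ∀ a p n c m t q →
      (x ^ a * ev p y) * (((term n (ev q y) c) * y ^ m) * z ^ t)
      ≈ term (a +ℕ n) (ι (αi K.^ (m *ℕ c)) * (y ^ m * (ev (substP p (αi K.^ n)) y * ev q y))) (c +ℕ t)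
    x^ev*term*y^*z^ a p n c m t q = begin
      (X * e) * ((((Xn * w) * Zc) * Ym) * Zt)           ≈⟨ *-congˡ (*-congʳ (*-assoc _ _ _)) ⟩
      (X * e) * (((Xn * w) * (Zc * Ym)) * Zt)           ≈⟨ *-congˡ (*-congʳ (*-congˡ (QCommuting.^-commute αi z*y m c))) ⟩
      (X * e) * (((Xn * w) * (ι s * (Ym * Zc))) * Zt)   ≈⟨ *-congˡ (trans (*-congʳ (ι-float _ _ _)) (*-assoc _ _ _)) ⟩
      (X * e) * (ι s * (((Xn * w) * (Ym * Zc)) * Zt))   ≈⟨ ι-float _ _ _ ⟩
      ι s * ((X * e) * (((Xn * w) * (Ym * Zc)) * Zt))   ≈⟨ *-congˡ (solve 7 (λ X e Xn w Ym Zc Zt →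
                                                             (X ⊕ e) ⊕ (((Xn ⊕ w) ⊕ (Ym ⊕ Zc)) ⊕ Zt) ⊜ X ⊕ ((e ⊕ Xn) ⊕ (w ⊕ (Ym ⊕ (Zc ⊕ Zt)))))
                                                             refl X e Xn w Ym Zc Zt) ⟩
      ι s * (X * ((e * Xn) * (w * (Ym * (Zc * Zt)))))   ≈⟨ *-congˡ (*-congˡ (*-congʳ (ev*x^ p n))) ⟩
      ι s * (X * ((Xn * e′) * (w * (Ym * (Zc * Zt))))) ≈⟨ *-congˡ (solve 7 (λ X Xn e′ w Ym Zc Zt →
                                                             X ⊕ ((Xn ⊕ e′) ⊕ (w ⊕ (Ym ⊕ (Zc ⊕ Zt)))) ⊜ ((X ⊕ Xn) ⊕ ((e′ ⊕ w) ⊕ Ym)) ⊕ (Zc ⊕ Zt))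
                                                             refl X Xn e′ w Ym Zc Zt) ⟩
      ι s * (((X * Xn) * ((e′ * w) * Ym)) * (Zc * Zt))  ≈⟨ *-congˡ (*-cong (*-cong (sym (^-distribˡ-+-* x a n)) y^-first)
                                                                            (sym (^-distribˡ-+-* z c t))) ⟩
      ι s * ((x ^ (a +ℕ n) * (Ym * (e′ * w))) * z ^ (c +ℕ t)) ≈⟨ trans (sym (*-assoc _ _ _)) (*-congʳ (sym (ι-float _ _ _))) ⟩
      term (a +ℕ n) (ι s * (Ym * (e′ * w))) (c +ℕ t)   ∎
      where
      X e Xn w Zc Ym Zt e′ : Carrier
      X  = x ^ a
      e  = ev p y
      Xn = x ^ n
      w  = ev q y
      Zc = z ^ c
      Ym = y ^ m
      Zt = z ^ t
      e′ = ev (substP p (αi K.^ n)) y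
      s : K.Carrier
      s = αi K.^ (m *ℕ c)
      y^-first : (e′ * w) * Ym ≈ Ym * (e′ * w)
      y^-first = begin
        (e′ * w) * Ym                               ≈⟨ *-congʳ (ev-*P (substP p (αi K.^ n)) q y) ⟨
        ev (substP p (αi K.^ n) *P q) y * Ym        ≈⟨ y^*ev m (substP p (αi K.^ n) *P q) ⟨
        Ym * ev (substP p (αi K.^ n) *P q) y        ≈⟨ *-congˡ (ev-*P (substP p (αi K.^ n)) q y) ⟩
        Ym * (e′ * w)                               ∎

    module Powers (n m t : ℕ) where
      open RFamily n m t

      g : Carrier
      g = (x ^ n * y ^ m) * z ^ t

      product-coeff : ℕ → Pol → ℕ → Carrier
      product-coeff c p k = ι (αi K.^ (m *ℕ (c ∸ k))) * (y ^ m * (ev (substP p (αi K.^ (n ∸ k))) y * ev (W n c k) y))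

      term*g : ∀ a p c → term a (ev p y) c * g ≈ Σ≤ n (λ k → term (a +ℕ (n ∸ k)) (product-coeff c p k) ((c ∸ k) +ℕ t))
      term*g a p c = begin
        ((X * e) * Zc) * ((Xn * Ym) * Zt)          ≈⟨ solve 6 (λ X e Zc Xn Ym Zt →
                                                        ((X ⊕ e) ⊕ Zc) ⊕ ((Xn ⊕ Ym) ⊕ Zt) ⊜ (X ⊕ e) ⊕ (((Zc ⊕ Xn) ⊕ Ym) ⊕ Zt))
                                                        refl X e Zc Xn Ym Zt ⟩
        (X * e) * (((Zc * Xn) * Ym) * Zt)          ≈⟨ *-congˡ (*-congʳ (*-congʳ (z^*x^-wide n c))) ⟩
        (X * e) * ((Σ≤ n zxₖ * Ym) * Zt)     ≈⟨ *-congˡ (trans (*-congʳ (*-distribʳ-Σ≤ Ym n zxₖ)) (*-distribʳ-Σ≤ Zt n _)) ⟩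
        (X * e) * Σ≤ n (λ k → (zxₖ k * Ym) * Zt) ≈⟨ *-distribˡ-Σ≤ (X * e) n _ ⟩
        Σ≤ n (λ k → (X * e) * ((zxₖ k * Ym) * Zt)) ≈⟨ ∑-cong n (λ k _ → x^ev*term*y^*z^ a p (n ∸ k) (c ∸ k) m t (W n c k)) ⟩
        Σ≤ n (λ k → term (a +ℕ (n ∸ k)) (product-coeff c p k) ((c ∸ k) +ℕ t)) ∎
        where
        X e Zc Xn Ym Zt : Carrier
        X  = x ^ a
        e  = ev p y
        Zc = z ^ c
        Xn = x ^ n
        Ym = y ^ m
        Zt = z ^ t
        zxₖ : ℕ → Carrier
        zxₖ k = term (n ∸ k) (ev (W n c k) y) (c ∸ k)

      R-term : ℕ → ℕ → ℕ → Carrier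
      R-term S ℓ k = term (n *ℕ suc S ∸ (ℓ +ℕ k)) (ev (R-summand S (ℓ +ℕ k) ℓ k) y) (t *ℕ suc S ∸ (ℓ +ℕ k))

      private
        ev-R-summand : ∀ S ℓ k → ℓ +ℕ k ≤ t *ℕ S → ev (R-summand S (ℓ +ℕ k) ℓ k) y ≈ product-coeff (t *ℕ S ∸ ℓ) (R n m t S ℓ) k
        ev-R-summand S ℓ k ℓ+k≤tS = begin
          ev (R-summand S (ℓ +ℕ k) ℓ k) y
            ≈⟨ ev-scaleP _ (yPow m *P (Rℓ *P W⁻ n (t *ℕ S) ℓ k)) y ⟩
          ι (α^- ((+ (t *ℕ S) -ℤ + (ℓ +ℕ k)) *ℤ + m)) * ev (yPow m *P (Rℓ *P W⁻ n (t *ℕ S) ℓ k)) y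
            ≈⟨ *-cong (reflexive (≡.cong ι scalar≡))
                 (trans (ev-*P (yPow m) _ y) (*-cong (ev-yPow m y) (ev-*P Rℓ _ y))) ⟩
          ι (αi K.^ (m *ℕ ((t *ℕ S ∸ ℓ) ∸ k))) * (y ^ m * (ev Rℓ y * ev (W⁻ n (t *ℕ S) ℓ k) y))
            ≡⟨ ≡.cong (λ q → ι (αi K.^ (m *ℕ ((t *ℕ S ∸ ℓ) ∸ k))) * (y ^ m * (ev Rℓ y * ev q y)))
                 (if-≤ᵇ-true (ℕ.m+n≤o⇒m≤o ℓ ℓ+k≤tS)) ⟩
          product-coeff (t *ℕ S ∸ ℓ) (R n m t S ℓ) k                                    ∎
          where
          Rℓ : Pol
          Rℓ = substP (R n m t S ℓ) (αi K.^ (n ∸ k))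
          scalar≡ : α^- ((+ (t *ℕ S) -ℤ + (ℓ +ℕ k)) *ℤ + m) ≡ αi K.^ (m *ℕ ((t *ℕ S ∸ ℓ) ∸ k))
          scalar≡ = ≡.trans (≡.cong α^-_ ([+m-+n]*+o≡+[[m∸n]*o] m ℓ+k≤tS))
                            (≡.cong (αi K.^_) (≡.trans (ℕ.*-comm _ m) (≡.cong (m *ℕ_) (≡.sym (ℕ.∸-+-assoc (t *ℕ S) ℓ k)))))

        product-coeff-vanishes : ∀ s ℓ k → t *ℕ suc s < ℓ +ℕ k → product-coeff (t *ℕ suc s ∸ ℓ) (R n m t (suc s) ℓ) k ≈ 0#
        product-coeff-vanishes s ℓ k ts<ℓ+k = trans (*-congˡ (trans (*-congˡ R*W≈0) (zeroʳ _))) (zeroʳ _)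
          where
          R*W≈0 : ev (substP (R n m t (suc s) ℓ) (αi K.^ (n ∸ k))) y * ev (W n (t *ℕ suc s ∸ ℓ) k) y ≈ 0#
          R*W≈0 with ℓ ℕ.≤? t *ℕ suc s
          ... | yes ℓ≤ts = trans (*-congˡ (vanishes (W-vanishes n (m<n+o⇒n≤m⇒m∸n<o ts<ℓ+k ℓ≤ts)) y)) (zeroʳ _)
          ... | no ℓ≰ts  = trans (*-congʳ (vanishes (substP-vanishes _ (R-vanishes-z s ℓ (ℕ.≰⇒> ℓ≰ts))) y)) (zeroˡ _)

      product-coeff-term≈R-term : ∀ s ℓ k → ℓ ≤ n *ℕ suc s → k ≤ n →
        term ((n *ℕ suc s ∸ ℓ) +ℕ (n ∸ k)) (product-coeff (t *ℕ suc s ∸ ℓ) (R n m t (suc s) ℓ) k) (((t *ℕ suc s ∸ ℓ) ∸ k) +ℕ t)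
        ≈ R-term (suc s) ℓ k
      product-coeff-term≈R-term s ℓ k ℓ≤ns k≤n with ℓ +ℕ k ℕ.≤? t *ℕ suc s
      ... | yes ℓ+k≤ts = begin
        term ((n *ℕ suc s ∸ ℓ) +ℕ (n ∸ k)) (product-coeff (t *ℕ suc s ∸ ℓ) (R n m t (suc s) ℓ) k) (((t *ℕ suc s ∸ ℓ) ∸ k) +ℕ t)
          ≡⟨ ≡.cong₂ (λ i j → term i (product-coeff (t *ℕ suc s ∸ ℓ) (R n m t (suc s) ℓ) k) j)
             (≡.trans ([m∸n]+[o∸p]≡[o+m]∸[n+p] ℓ≤ns k≤n) (≡.cong (_∸ (ℓ +ℕ k)) (≡.sym (ℕ.*-suc n (suc s)))))
             (≡.trans ([m∸n∸p]+o≡[o+m]∸[n+p] {n = ℓ} {o = t} {p = k} ℓ+k≤ts) (≡.cong (_∸ (ℓ +ℕ k)) (≡.sym (ℕ.*-suc t (suc s))))) ⟩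
        term (n *ℕ suc (suc s) ∸ (ℓ +ℕ k)) (product-coeff (t *ℕ suc s ∸ ℓ) (R n m t (suc s) ℓ) k) (t *ℕ suc (suc s) ∸ (ℓ +ℕ k))
          ≈⟨ term-cong (n *ℕ suc (suc s) ∸ (ℓ +ℕ k)) (t *ℕ suc (suc s) ∸ (ℓ +ℕ k)) (ev-R-summand (suc s) ℓ k ℓ+k≤ts) ⟨
        R-term (suc s) ℓ k ∎
      ... | no ℓ+k≰ts = trans (term-zero ((n *ℕ suc s ∸ ℓ) +ℕ (n ∸ k)) (((t *ℕ suc s ∸ ℓ) ∸ k) +ℕ t) (product-coeff-vanishes s ℓ k (ℕ.≰⇒> ℓ+k≰ts)))
        (sym (term-zero (n *ℕ suc (suc s) ∸ (ℓ +ℕ k)) (t *ℕ suc (suc s) ∸ (ℓ +ℕ k))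
          (vanishes (scaleP-vanishes _ (*P-vanishesʳ (yPow m) (*P-vanishesʳ (substP (R n m t (suc s) ℓ) (αi K.^ (n ∸ k)))
            (W⁻-vanishes n (t *ℕ suc s) ℓ k (ℕ.≰⇒> ℓ+k≰ts))))) y)))

      private
        R-term-vanishes : ∀ s a k → n *ℕ suc s < a → R-term (suc s) a k ≈ 0#
        R-term-vanishes s a k ns<a = term-zero (n *ℕ suc (suc s) ∸ (a +ℕ k)) (t *ℕ suc (suc s) ∸ (a +ℕ k))
          (vanishes (scaleP-vanishes _ (*P-vanishesʳ (yPow m) (*P-vanishesˡ (W⁻ n (t *ℕ suc s) a k)
            (substP-vanishes (αi K.^ (n ∸ k)) (R-vanishes-x s a ns<a))))) y)

        ∑-R-term : ∀ S L → Σ≤ (n ⊓ L) (λ k → R-term (suc S) (L ∸ k) k)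
                           ≈ term (n *ℕ suc (suc S) ∸ L) (ev (R n m t (suc (suc S)) L) y) (t *ℕ suc (suc S) ∸ L)
        ∑-R-term S L = begin
          Σ≤ (n ⊓ L) (λ k → R-term (suc S) (L ∸ k) k)
            ≈⟨ ∑-cong (n ⊓ L) (λ k k≤n⊓L → reflexive (≡.cong (λ L′ → term (nS′ ∸ L′) (ev (R-summand (suc S) L′ (L ∸ k) k) y) (tS′ ∸ L′))
               (ℕ.m∸n+n≡m (ℕ.≤-trans k≤n⊓L (ℕ.m⊓n≤n n L))))) ⟩
          Σ≤ (n ⊓ L) (λ k → term (nS′ ∸ L) (ev (R-summand (suc S) L (L ∸ k) k) y) (tS′ ∸ L))
            ≈⟨ term-Σ≤ (nS′ ∸ L) (n ⊓ L) _ (tS′ ∸ L) ⟩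
          term (nS′ ∸ L) (Σ≤ (n ⊓ L) (λ k → ev (R-summand (suc S) L (L ∸ k) k) y)) (tS′ ∸ L)
            ≈⟨ term-cong (nS′ ∸ L) (tS′ ∸ L) (ev-R-suc S L y) ⟨
          term (nS′ ∸ L) (ev (R n m t (suc (suc S)) L) y) (tS′ ∸ L) ∎
          where
          nS′ tS′ : ℕ
          nS′ = n *ℕ suc (suc S)
          tS′ = t *ℕ suc (suc S)

      R-expansion-wide : ∀ s → g ^ s ≈ Σ≤ (n *ℕ s) (λ ℓ → term (n *ℕ s ∸ ℓ) (ev (R n m t s ℓ) y) (t *ℕ s ∸ ℓ))
      R-expansion-wide zero rewrite ℕ.*-zeroʳ n | ℕ.*-zeroʳ t =
        sym (trans (*-identityʳ _) (trans (*-identityˡ _) (ev-1P y)))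
      R-expansion-wide (suc zero) rewrite ℕ.*-identityʳ n | ℕ.*-identityʳ t = begin
        g * 1#                                              ≈⟨ *-identityʳ g ⟩
        g                                                   ≈⟨ *-congʳ (*-congˡ (ev-yPow m y)) ⟨
        term n (ev (yPow m) y) t                            ≈⟨ ∑-single n 0 _ z≤n higher≈0 ⟨
        Σ≤ n (λ ℓ → term (n ∸ ℓ) (ev (R n m t 1 ℓ) y) (t ∸ ℓ)) ∎
        where
        higher≈0 : ∀ ℓ → ℓ ≤ n → ℓ ≢ 0 → term (n ∸ ℓ) (ev (R n m t 1 ℓ) y) (t ∸ ℓ) ≈ 0#
        higher≈0 zero    _ ℓ≢0 = ⊥-elim (ℓ≢0 ≡.refl)
        higher≈0 (suc ℓ) _ _   = term-zero (n ∸ suc ℓ) (t ∸ suc ℓ) refl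
      R-expansion-wide (suc (suc s)) = begin
        g * g ^ S                                                       ≈⟨ trans (^-sucʳ g S) (*-congʳ (R-expansion-wide (suc s))) ⟩
        Σ≤ (n *ℕ S) current * g                                         ≈⟨ *-distribʳ-Σ≤ g (n *ℕ S) current ⟩
        Σ≤ (n *ℕ S) (λ ℓ → current ℓ * g)
          ≈⟨ ∑-cong (n *ℕ S) (λ ℓ ℓ≤nS → trans (term*g (n *ℕ S ∸ ℓ) (R n m t S ℓ) (t *ℕ S ∸ ℓ))
             (∑-cong n (λ k k≤n → product-coeff-term≈R-term s ℓ k ℓ≤nS k≤n))) ⟩
        Σ≤ (n *ℕ S) (λ ℓ → Σ≤ n (R-term S ℓ))                           ≈⟨ ∑∑-antidiagonal (n *ℕ S) n (R-term S)
                                                                             (λ a k ns<a _ → R-term-vanishes s a k ns<a) ⟩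
        Σ≤ (n *ℕ S +ℕ n) (λ L → Σ≤ (n ⊓ L) (λ k → R-term S (L ∸ k) k))  ≈⟨ ∑-cong (n *ℕ S +ℕ n) (λ L _ → ∑-R-term s L) ⟩
        Σ≤ (n *ℕ S +ℕ n) next
          ≡⟨ ≡.cong (λ N → Σ≤ N next) (≡.trans (ℕ.+-comm (n *ℕ S) n) (≡.sym (ℕ.*-suc n S))) ⟩
        Σ≤ (n *ℕ suc S) next                                            ∎
        where
        S : ℕ
        S = suc s
        current next : ℕ → Carrier
        current ℓ = term (n *ℕ S ∸ ℓ) (ev (R n m t S ℓ) y) (t *ℕ S ∸ ℓ)
        next L    = term (n *ℕ suc S ∸ L) (ev (R n m t (suc S) L) y) (t *ℕ suc S ∸ L)

      R-expansion : ∀ s → g ^ s ≈ Σ≤ ((n *ℕ s) ⊓ (t *ℕ s)) (λ ℓ → x ^ (n *ℕ s ∸ ℓ) * ev (R n m t s ℓ) y * z ^ (t *ℕ s ∸ ℓ))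
      R-expansion s = trans (R-expansion-wide s) (∑-truncate (n *ℕ s) _ (ℕ.m⊓n≤m (n *ℕ s) (t *ℕ s)) (beyond s))
        where
        beyond : ∀ s k → (n *ℕ s) ⊓ (t *ℕ s) < k → k ≤ n *ℕ s → term (n *ℕ s ∸ k) (ev (R n m t s k) y) (t *ℕ s ∸ k) ≈ 0#
        beyond zero k ⊓<k k≤n0 = ⊥-elim (ℕ.<⇒≱ (m⊓n<o⇒o≤m⇒n<o ⊓<k k≤n0)
                                                (≡.subst (k ≤_) (≡.trans (ℕ.*-zeroʳ n) (≡.sym (ℕ.*-zeroʳ t))) k≤n0))
        beyond (suc s) k ⊓<k k≤ns = term-zero (n *ℕ suc s ∸ k) (t *ℕ suc s ∸ k)
          (vanishes (R-vanishes-z s k (m⊓n<o⇒o≤m⇒n<o ⊓<k k≤ns)) y)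

    x^z^-power : ∀ n m s → ((x ^ n) * (z ^ m)) ^ s
                 ≈ Σ≤ ((n *ℕ s) ⊓ (m *ℕ s)) (λ ℓ → (x ^ (n *ℕ s ∸ ℓ)) * ev (U n m s ℓ) y * (z ^ (m *ℕ s ∸ ℓ)))
    x^z^-power n m s = begin
      ((x ^ n) * (z ^ m)) ^ s                                         ≈⟨ ^-cong s (*-congʳ (*-identityʳ _)) ⟨
      ((x ^ n * y ^ 0) * z ^ m) ^ s                                   ≈⟨ Powers.R-expansion n 0 m s ⟩
      Σ≤ ((n *ℕ s) ⊓ (m *ℕ s)) (λ ℓ → term (n *ℕ s ∸ ℓ) (ev (R n 0 m s ℓ) y) (m *ℕ s ∸ ℓ))
        ≈⟨ ∑-cong ((n *ℕ s) ⊓ (m *ℕ s)) (λ ℓ _ →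
             term-cong (n *ℕ s ∸ ℓ) (m *ℕ s ∸ ℓ) (ev-U≈ev-R n m s ℓ y)) ⟨
      Σ≤ ((n *ℕ s) ⊓ (m *ℕ s)) (λ ℓ → term (n *ℕ s ∸ ℓ) (ev (U n m s ℓ) y) (m *ℕ s ∸ ℓ)) ∎

    xyz-power : ∀ s → (x * y * z) ^ s ≈ Σ≤ s (λ ℓ → (x ^ (s ∸ ℓ)) * ev (V s ℓ) y * (z ^ (s ∸ ℓ)))
    xyz-power s = begin
      (x * y * z) ^ s
        ≈⟨ ^-cong s (*-cong (*-cong (*-identityʳ x) (*-identityʳ y)) (*-identityʳ z)) ⟨
      ((x ^ 1 * y ^ 1) * z ^ 1) ^ s                                   ≈⟨ ≡.subst (λ N → ((x ^ 1 * y ^ 1) * z ^ 1) ^ s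
                                                                              ≈ Σ≤ (N ⊓ N) (λ ℓ → term (N ∸ ℓ) (ev (R 1 1 1 s ℓ) y) (N ∸ ℓ)))
                                                                           (ℕ.*-identityˡ s) (Powers.R-expansion 1 1 1 s) ⟩
      Σ≤ (s ⊓ s) (λ ℓ → term (s ∸ ℓ) (ev (R 1 1 1 s ℓ) y) (s ∸ ℓ))
        ≡⟨ ≡.cong (λ N → Σ≤ N (λ ℓ → term (s ∸ ℓ) (ev (R 1 1 1 s ℓ) y) (s ∸ ℓ))) (ℕ.⊓-idem s) ⟩
      Σ≤ s (λ ℓ → term (s ∸ ℓ) (ev (R 1 1 1 s ℓ) y) (s ∸ ℓ))
        ≈⟨ ∑-cong s (λ ℓ _ → term-cong (s ∸ ℓ) (s ∸ ℓ) (ev-V≈ev-R s ℓ y)) ⟨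
      Σ≤ s (λ ℓ → term (s ∸ ℓ) (ev (V s ℓ) y) (s ∸ ℓ))                ∎

    z^*x : ∀ k → z ^ k * x ≈ term 1 (ι (β K.^ k)) k + term 0 (ev (P k) y) (k ∸ 1)
    z^*x k = begin
      z ^ k * x                                                     ≈⟨ *-congˡ (*-identityʳ x) ⟨
      z ^ k * x ^ 1                                                 ≈⟨ z^*x^-wide 1 k ⟩
      term 1 (ev (W 1 k 0) y) k + term 0 (ev (W 1 k 1) y) (k ∸ 1)
        ≈⟨ +-cong (term-cong 1 k (ev-W-1-0 k y)) (term-cong 0 (k ∸ 1) (ev-W-1-1 k y)) ⟩
      term 1 (ι (β K.^ k)) k + term 0 (ev (P k) y) (k ∸ 1)          ∎

    term*x : ∀ i q k → term i (ev q y) k * x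
             ≈ term (suc i) (ι (β K.^ k) * ev (substP q αi) y) k + term i (ev q y * ev (P k) y) (k ∸ 1)
    term*x i q k = begin
      ((X * e) * Zk) * x                                    ≈⟨ trans (*-assoc _ _ _) (*-congˡ (z^*x k)) ⟩
      (X * e) * (term 1 βᵏ k + term 0 Pk (k ∸ 1))            ≈⟨ distribˡ _ _ _ ⟩
      (X * e) * term 1 βᵏ k + (X * e) * term 0 Pk (k ∸ 1)    ≈⟨ +-cong x-past-q (solve 4 (λ X e Pk Zk′ →
                                                                 (X ⊕ e) ⊕ ((one ⊕ Pk) ⊕ Zk′) ⊜ (X ⊕ (e ⊕ Pk)) ⊕ Zk′) refl X e Pk (z ^ (k ∸ 1))) ⟩
      term (suc i) (βᵏ * e′) k + term i (e * Pk) (k ∸ 1)     ∎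
      where
      X e e′ βᵏ Pk Zk : Carrier
      X  = x ^ i
      e  = ev q y
      e′ = ev (substP q αi) y
      βᵏ  = ι (β K.^ k)
      Pk = ev (P k) y
      Zk = z ^ k
      x-past-q : (X * e) * ((x ^ 1 * βᵏ) * Zk) ≈ term (suc i) (βᵏ * e′) k
      x-past-q = begin
        (X * e) * ((x ^ 1 * βᵏ) * Zk)       ≈⟨ *-congˡ (*-congʳ (*-congʳ (*-identityʳ x))) ⟩
        (X * e) * ((x * βᵏ) * Zk)
          ≈⟨ solve 5 (λ X e x βᵏ Zk → (X ⊕ e) ⊕ ((x ⊕ βᵏ) ⊕ Zk) ⊜ (X ⊕ (e ⊕ x)) ⊕ (βᵏ ⊕ Zk)) refl X e x βᵏ Zk ⟩
        (X * (e * x)) * (βᵏ * Zk)           ≈⟨ *-congʳ (*-congˡ (ev*x q)) ⟩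
        (X * (x * e′)) * (βᵏ * Zk)
          ≈⟨ solve 5 (λ X x e′ βᵏ Zk → (X ⊕ (x ⊕ e′)) ⊕ (βᵏ ⊕ Zk) ⊜ ((X ⊕ x) ⊕ (e′ ⊕ βᵏ)) ⊕ Zk) refl X x e′ βᵏ Zk ⟩
        ((X * x) * (e′ * βᵏ)) * Zk          ≈⟨ *-congʳ (*-cong (sym (^-sucʳ x i)) (sym (ι-central _ _))) ⟩
        term (suc i) (βᵏ * e′) k            ∎

    term*z : ∀ i p k → term i p k * z ≈ term i p (suc k)
    term*z i p k = trans (*-assoc _ _ _) (*-congˡ (sym (^-sucʳ z k)))

    private
      module XZStep (n : ℕ) where
        N : ℕ
        N = suc n

        current byZ byX byP prevK prevI viaP : ℕ → ℕ → Carrier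
        current i k = term i (ev (E n i k) y) k
        byZ i k     = term i (ev (E n i k) y) (suc k)
        byX i k     = term (suc i) (ι (β K.^ k) * ev (substP (E n i k) αi) y) k
        byP i k     = term i (ev (E n i k) y * ev (P k) y) (k ∸ 1)
        prevK i k   = term i (ev (Eₖ₋₁ n i k) y) k
        prevI i k   = term i (ev (Eᵢ₋₁ n i k) y) k
        viaP i k    = term i (ev (P (suc k) *P E n i (suc k)) y) k

        current*[x+z] : ∀ i k → current i k * (x + z) ≈ byZ i k + byX i k + byP i k
        current*[x+z] i k = begin
          current i k * (x + z)                    ≈⟨ distribˡ _ _ _ ⟩
          current i k * x + current i k * z        ≈⟨ +-cong (term*x i (E n i k) k) (term*z i _ k) ⟩
          (byX i k + byP i k) + byZ i k            ≈⟨ trans (+-comm _ _) (sym (+-assoc _ _ _)) ⟩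
          byZ i k + byX i k + byP i k              ∎

        unfold : ∀ i k → term i (ev (E N i k) y) k ≈ prevK i k + prevI i k + viaP i k
        unfold i k = trans (term-cong i k (ev-E-suc n i k y)) (trans (term-+ i _ _ k) (+-congʳ (term-+ i _ _ k)))

        ∑∑-prevK : Σ≤ N (λ i → Σ≤ N (prevK i)) ≈ Σ≤ n (λ i → Σ≤ n (byZ i))
        ∑∑-prevK = begin
          Σ≤ N (λ i → Σ≤ N (prevK i)) ≈⟨ ∑-cong N (λ i _ → ∑-tail n (prevK i) (term-zero i 0 refl)) ⟩
          Σ≤ N (λ i → Σ≤ n (byZ i))   ≈⟨ ∑-init n _ (∑-ε n (λ k _ →
                                           term-zero N (suc k) (vanishes (E-vanishes n N k (ℕ.m≤m+n N k)) y))) ⟩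
          Σ≤ n (λ i → Σ≤ n (byZ i))   ∎

        ∑∑-prevI : Σ≤ N (λ i → Σ≤ N (prevI i)) ≈ Σ≤ n (λ i → Σ≤ n (byX i))
        ∑∑-prevI = begin
          Σ≤ N (λ i → Σ≤ N (prevI i))       ≈⟨ ∑-tail n _ (∑-ε N (λ k _ → term-zero 0 k refl)) ⟩
          Σ≤ n (λ i → Σ≤ N (prevI (suc i))) ≈⟨ ∑-cong n (λ i _ → ∑-init n _ (term-zero (suc i) N
                                                 (vanishes (scaleP-vanishes _ (substP-vanishes αi (E-vanishes n i N (ℕ.m≤n+m N i)))) y))) ⟩
          Σ≤ n (λ i → Σ≤ n (prevI (suc i))) ≈⟨ ∑-cong n (λ i _ → ∑-cong n (λ k _ →
                                                 term-cong (suc i) k (ev-scaleP (β K.^ k) (substP (E n i k) αi) y))) ⟩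
          Σ≤ n (λ i → Σ≤ n (byX i))         ∎

        ∑∑-viaP : Σ≤ N (λ i → Σ≤ N (viaP i)) ≈ Σ≤ n (λ i → Σ≤ n (byP i))
        ∑∑-viaP = begin
          Σ≤ N (λ i → Σ≤ N (viaP i)) ≈⟨ ∑-init n _ (∑-ε N (λ k _ → term-zero N k
                                          (vanishes (*P-vanishesʳ (P (suc k)) (E-vanishes n N (suc k) (ℕ.m≤m+n N (suc k)))) y))) ⟩
          Σ≤ n (λ i → Σ≤ N (viaP i)) ≈⟨ ∑-cong n (λ i _ → row i) ⟩
          Σ≤ n (λ i → Σ≤ n (byP i))  ∎
          where
          row : ∀ i → Σ≤ N (viaP i) ≈ Σ≤ n (byP i)
          row i = begin
            Σ≤ N (viaP i)               ≈⟨ ∑-init n (viaP i) (term-zero i N (vanishes (*P-vanishesʳ (P (suc N))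
                                             (E-vanishes n i (suc N) (ℕ.≤-trans (ℕ.n≤1+n N) (ℕ.m≤n+m (suc N) i)))) y)) ⟩
            Σ≤ n (viaP i)               ≈⟨ ∑-cong n (λ k _ → term-cong i k (trans (ev-*P (P (suc k)) (E n i (suc k)) y)
                                                                                   (ev-*-comm (P (suc k)) (E n i (suc k)) y))) ⟩
            Σ≤ n (λ k → byP i (suc k))  ≈⟨ ∑-tail n (byP i) (term-zero i 0 (trans (*-congˡ (ev-P-0 y)) (zeroʳ _))) ⟨
            Σ≤ N (byP i)
              ≈⟨ ∑-init n (byP i) (term-zero i n (trans (*-congʳ (vanishes (E-vanishes n i N (ℕ.m≤n+m N i)) y)) (zeroˡ _))) ⟩
            Σ≤ n (byP i)                ∎

    x+z-power-wide : ∀ n → (x + z) ^ n ≈ Σ≤ n (λ i → Σ≤ n (λ k → term i (ev (E n i k) y) k))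
    x+z-power-wide zero = sym (trans (*-identityʳ _) (trans (*-identityˡ _) (ev-1P y)))
    x+z-power-wide (suc n) = begin
      (x + z) * (x + z) ^ n                                       ≈⟨ trans (^-sucʳ (x + z) n) (*-congʳ (x+z-power-wide n)) ⟩
      Σ≤ n (λ i → Σ≤ n (current i)) * (x + z)
        ≈⟨ trans (*-distribʳ-Σ≤ (x + z) n _) (∑-cong n (λ i _ → *-distribʳ-Σ≤ (x + z) n (current i))) ⟩
      Σ≤ n (λ i → Σ≤ n (λ k → current i k * (x + z)))             ≈⟨ ∑-cong n (λ i _ → ∑-cong n (λ k _ → current*[x+z] i k)) ⟩
      Σ≤ n (λ i → Σ≤ n (λ k → byZ i k + byX i k + byP i k))
        ≈⟨ trans (∑∑-distrib-∙ n n _ byP) (+-congʳ (∑∑-distrib-∙ n n byZ byX)) ⟩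
      ΣΣ n byZ + ΣΣ n byX + ΣΣ n byP                              ≈⟨ +-cong (+-cong ∑∑-prevK ∑∑-prevI) ∑∑-viaP ⟨
      ΣΣ N prevK + ΣΣ N prevI + ΣΣ N viaP
        ≈⟨ trans (∑∑-distrib-∙ N N _ viaP) (+-congʳ (∑∑-distrib-∙ N N prevK prevI)) ⟨
      Σ≤ N (λ i → Σ≤ N (λ k → prevK i k + prevI i k + viaP i k))  ≈⟨ ∑-cong N (λ i _ → ∑-cong N (λ k _ → unfold i k)) ⟨
      Σ≤ N (λ i → Σ≤ N (λ k → term i (ev (E N i k) y) k))         ∎
      where
      open XZStep n
      ΣΣ : ℕ → (ℕ → ℕ → Carrier) → Carrier
      ΣΣ M f = Σ≤ M (λ i → Σ≤ M (f i))

    x+z-power : ∀ n → (x + z) ^ n ≈ Σ≤ n (λ i → Σ≤ (n ∸ i) (λ k → (x ^ i) * ev (E n i k) y * (z ^ k)))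
    x+z-power n = trans (x+z-power-wide n) (∑-cong n (λ i i≤n → ∑-truncate n _ (ℕ.m∸n≤m n i) (λ k n∸i<k _ →
      term-zero i k (vanishes (E-vanishes n i k (≡.subst (_< i +ℕ k) (ℕ.m+[n∸m]≡n i≤n) (ℕ.+-monoʳ-< i n∸i<k))) y))))

module Uniqueness {c ℓ a ℓa} (F : Field c ℓ) (A : FAlgebra F a ℓa) (x y z : FAlgebra.Carrier A)
  (pbw : IsPBWBasis A x y z) where

  open FAlgebra A
  open AlgebraFacts F A
  open NormalTerms F A x z
  open Poly F
  open import Algebra.Properties.Ring ring using (+-identityʳ-unique; -1*x≈-x)
  open import Algebra.Properties.Ring K.ring using (x∙y⁻¹≈ε⇒x≈y) renaming (-1*x≈-x to -1*a≈-a)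
  open import Relation.Binary.Reasoning.Setoid setoid

  ΣK : ℕ → (ℕ → K.Carrier) → K.Carrier
  ΣK zero    f = f 0
  ΣK (suc n) f = ΣK n f K.+ f (suc n)

  private
    module SK = SumLaws K.+-commutativeMonoid ΣK (λ _ → K.refl) (λ _ _ → K.refl)

  ι-ΣK : ∀ n g → ι (ΣK n g) ≈ Σ≤ n (λ k → ι (g k))
  ι-ΣK zero    g = refl
  ι-ΣK (suc n) g = trans (ι-+ _ _) (+-congʳ (ι-ΣK n g))

  δ : ℕ → ℕ → K.Carrier → K.Carrier
  δ zero    zero    v = v
  δ zero    (suc i) v = K.0#
  δ (suc a) zero    v = K.0#
  δ (suc a) (suc i) v = δ a i v

  δ-same : ∀ a v → δ a a v ≡ v
  δ-same zero    v = ≡.refl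
  δ-same (suc a) v = δ-same a v

  δ-diff : ∀ {a i} v → a ≢ i → δ a i v ≡ K.0#
  δ-diff {zero}  {zero}  v a≢i = ⊥-elim (a≢i ≡.refl)
  δ-diff {zero}  {suc i} v _   = ≡.refl
  δ-diff {suc a} {zero}  v _   = ≡.refl
  δ-diff {suc a} {suc i} v a≢i = δ-diff v (λ a≡i → a≢i (≡.cong suc a≡i))

  δ-0 : ∀ a i → δ a i K.0# ≡ K.0#
  δ-0 zero    zero    = ≡.refl
  δ-0 zero    (suc i) = ≡.refl
  δ-0 (suc a) zero    = ≡.refl
  δ-0 (suc a) (suc i) = δ-0 a i

  coeff-beyond-length : ∀ p j → length p ≤ j → coeff p j ≡ K.0#
  coeff-beyond-length []      j       _          = ≡.refl
  coeff-beyond-length (b ∷ p) (suc j) (s≤s p≤j) = coeff-beyond-length p j p≤j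

  Σ-coeff≈ev : ∀ p M → length p ≤ M → Σ≤ M (λ j → ι (coeff p j) * y ^ j) ≈ ev p y
  Σ-coeff≈ev []      M       _         = ∑-ε M (λ k _ → trans (*-congʳ ι-0) (zeroˡ _))
  Σ-coeff≈ev (b ∷ p) (suc M) (s≤s p≤M) = begin
    Σ≤ (suc M) (λ j → ι (coeff (b ∷ p) j) * y ^ j)            ≈⟨ ∑-head M _ ⟩
    ι b * 1# + Σ≤ M (λ j → ι (coeff p j) * (y * y ^ j))       ≈⟨ +-cong (*-identityʳ _) (∑-cong M (λ j _ → sym (ι-float _ _ _))) ⟩
    ι b + Σ≤ M (λ j → y * (ι (coeff p j) * y ^ j))            ≈⟨ +-congˡ (*-distribˡ-Σ≤ y M _) ⟨
    ι b + y * Σ≤ M (λ j → ι (coeff p j) * y ^ j)              ≈⟨ +-congˡ (*-congˡ (Σ-coeff≈ev p M p≤M)) ⟩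
    ι b + y * ev p y                                          ∎

  combo-δ : ∀ M a c p → a ≤ M → c ≤ M → length p ≤ M →
            combo A x y z M (λ i j k → δ a i (δ c k (coeff p j))) ≈ term a (ev p y) c
  combo-δ M a c p a≤M c≤M p≤M = begin
    Σ≤ M (λ i → Σ≤ M (λ j → Σ≤ M (λ k → ι (δ a i (δ c k (coeff p j))) * mono A x y z i j k)))
      ≈⟨ ∑-cong M (λ i _ → ∑-cong M (λ j _ → ∑-single M c _ c≤M (λ k _ k≢c → coeff≈0 (≡.trans (≡.cong (δ a i) (δ-diff _ (≡.≢-sym k≢c))) (δ-0 a i))))) ⟩
    Σ≤ M (λ i → Σ≤ M (λ j → ι (δ a i (δ c c (coeff p j))) * mono A x y z i j c))
      ≈⟨ ∑-single M a _ a≤M (λ i _ i≢a → ∑-ε M (λ j _ → coeff≈0 (δ-diff _ (≡.≢-sym i≢a)))) ⟩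
    Σ≤ M (λ j → ι (δ a a (δ c c (coeff p j))) * mono A x y z a j c)
      ≈⟨ ∑-cong M (λ j _ → *-congʳ (reflexive (≡.cong ι (≡.trans (δ-same a _) (δ-same c _))))) ⟩
    Σ≤ M (λ j → ι (coeff p j) * ((x ^ a * y ^ j) * z ^ c))
      ≈⟨ ∑-cong M (λ j _ → trans (sym (*-assoc _ _ _)) (*-congʳ (sym (ι-float _ _ _)))) ⟩
    Σ≤ M (λ j → term a (ι (coeff p j) * y ^ j) c)
      ≈⟨ term-Σ≤ a M _ c ⟩
    term a (Σ≤ M (λ j → ι (coeff p j) * y ^ j)) c
      ≈⟨ term-cong a c (Σ-coeff≈ev p M p≤M) ⟩
    term a (ev p y) c ∎
    where
    coeff≈0 : ∀ {e : K.Carrier} {v} → e ≡ K.0# → ι e * v ≈ 0#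
    coeff≈0 e≡0 = trans (*-congʳ (trans (reflexive (≡.cong ι e≡0)) ι-0)) (zeroˡ _)

  coeff-+P : ∀ p q j → coeff (p +P q) j K.≈ coeff p j K.+ coeff q j
  coeff-+P []      q       j       = K.sym (K.+-identityˡ _)
  coeff-+P (a ∷ p) []      j       = K.sym (K.+-identityʳ _)
  coeff-+P (a ∷ p) (b ∷ q) zero    = K.refl
  coeff-+P (a ∷ p) (b ∷ q) (suc j) = coeff-+P p q j

  coeff-scaleP : ∀ s p j → coeff (scaleP s p) j K.≈ s K.* coeff p j
  coeff-scaleP s []      j       = K.sym (K.zeroʳ s)
  coeff-scaleP s (b ∷ p) zero    = K.refl
  coeff-scaleP s (b ∷ p) (suc j) = coeff-scaleP s p j

  _-P_ : Pol → Pol → Pol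
  p -P q = p +P scaleP (K.- K.1#) q

  coeff--P : ∀ p q j → coeff (p -P q) j K.≈ coeff p j K.- coeff q j
  coeff--P p q j = K.trans (coeff-+P p _ j) (K.+-congˡ (K.trans (coeff-scaleP _ q j) (-1*a≈-a _)))

  ev--P : ∀ p q u → ev p u ≈ ev q u + ev (p -P q) u
  ev--P p q u = begin
    ev p u                                  ≈⟨ +-identityˡ _ ⟨
    0# + ev p u                             ≈⟨ +-congʳ (-‿inverseʳ (ev q u)) ⟨
    (ev q u - ev q u) + ev p u              ≈⟨ trans (+-assoc _ _ _) (+-congˡ (+-comm _ _)) ⟩
    ev q u + (ev p u - ev q u)
      ≈⟨ +-congˡ (+-congˡ (trans (sym (-1*x≈-x _)) (*-congʳ (trans (-‿cong (sym ι-1)) (sym (ι-neg K.1#)))))) ⟩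
    ev q u + (ev p u + ι (K.- K.1#) * ev q u) ≈⟨ +-congˡ (trans (ev-+P p _ u) (+-congˡ (ev-scaleP _ q u))) ⟨
    ev q u + ev (p -P q) u                  ∎

  IndexInjective : ℕ → (ℕ → ℕ) → (ℕ → ℕ → ℕ) → (ℕ → ℕ → ℕ) → Set
  IndexInjective K₁ K₂ xe ze = ∀ {r s r′ s′} → r ≤ K₁ → s ≤ K₂ r → r′ ≤ K₁ → s′ ≤ K₂ r′ →
                               xe r s ≡ xe r′ s′ → ze r s ≡ ze r′ s′ → r ≡ r′ × s ≡ s′

  module Independence (K₁ : ℕ) (K₂ : ℕ → ℕ) (xe ze : ℕ → ℕ → ℕ) (inj : IndexInjective K₁ K₂ xe ze) where

    ∑∑ : (ℕ → ℕ → Pol) → Carrier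
    ∑∑ D = Σ≤ K₁ (λ r → Σ≤ (K₂ r) (λ s → term (xe r s) (ev (D r s) y) (ze r s)))

    private
      δ-coeffs : (ℕ → ℕ → Pol) → ℕ → ℕ → ℕ → K.Carrier
      δ-coeffs D i j k = ΣK K₁ (λ r → ΣK (K₂ r) (λ s → δ (xe r s) i (δ (ze r s) k (coeff (D r s) j))))

      pull : ∀ M (G : ℕ → ℕ → ℕ → Carrier) →
             Σ≤ M (λ i → Σ≤ K₁ (λ r → Σ≤ (K₂ r) (G i r))) ≈ Σ≤ K₁ (λ r → Σ≤ (K₂ r) (λ s → Σ≤ M (λ i → G i r s)))
      pull M G = trans (∑-comm M K₁ _) (∑-cong K₁ (λ r _ → ∑-comm M (K₂ r) (λ i → G i r)))

      combo-δ-coeffs : ∀ M D → (∀ r s → r ≤ K₁ → s ≤ K₂ r → xe r s ≤ M × ze r s ≤ M × length (D r s) ≤ M) →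
                       combo A x y z M (δ-coeffs D) ≈ ∑∑ D
      combo-δ-coeffs M D bounds = begin
        Σ≤ M (λ i → Σ≤ M (λ j → Σ≤ M (λ k → ι (δ-coeffs D i j k) * mono A x y z i j k)))
          ≈⟨ ∑-cong M (λ i _ → ∑-cong M (λ j _ → trans (∑-cong M (λ k _ → expand i j k)) (pull M (λ k r s → G r s i j k)))) ⟩
        Σ≤ M (λ i → Σ≤ M (λ j → Σ≤ K₁ (λ r → Σ≤ (K₂ r) (λ s → Σ≤ M (G r s i j)))))
          ≈⟨ ∑-cong M (λ i _ → pull M (λ j r s → Σ≤ M (G r s i j))) ⟩
        Σ≤ M (λ i → Σ≤ K₁ (λ r → Σ≤ (K₂ r) (λ s → Σ≤ M (λ j → Σ≤ M (G r s i j)))))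
          ≈⟨ pull M (λ i r s → Σ≤ M (λ j → Σ≤ M (G r s i j))) ⟩
        Σ≤ K₁ (λ r → Σ≤ (K₂ r) (λ s → combo A x y z M (λ i j k → δ (xe r s) i (δ (ze r s) k (coeff (D r s) j)))))
          ≈⟨ ∑-cong K₁ (λ r r≤ → ∑-cong (K₂ r) (λ s s≤ → let (xe≤ , ze≤ , D≤) = bounds r s r≤ s≤ in
             combo-δ M (xe r s) (ze r s) (D r s) xe≤ ze≤ D≤)) ⟩
        ∑∑ D ∎
        where
        G : ℕ → ℕ → ℕ → ℕ → ℕ → Carrier
        G r s i j k = ι (δ (xe r s) i (δ (ze r s) k (coeff (D r s) j))) * mono A x y z i j k
        expand : ∀ i j k → ι (δ-coeffs D i j k) * mono A x y z i j k ≈ Σ≤ K₁ (λ r → Σ≤ (K₂ r) (λ s → G r s i j k))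
        expand i j k = trans (*-congʳ (ι-ΣK K₁ _)) (trans (*-distribʳ-Σ≤ _ K₁ _)
                         (∑-cong K₁ (λ r _ → trans (*-congʳ (ι-ΣK (K₂ r) _)) (*-distribʳ-Σ≤ _ (K₂ r) _))))

      δ-coeffs-pick : ∀ D {r s} → r ≤ K₁ → s ≤ K₂ r → ∀ j → δ-coeffs D (xe r s) j (ze r s) K.≈ coeff (D r s) j
      δ-coeffs-pick D {r₀} {s₀} r₀≤ s₀≤ j =
        K.trans (SK.∑-single K₁ r₀ _ r₀≤ (λ r r≤ r≢r₀ → SK.∑-ε (K₂ r) (λ s s≤ → off r≤ s≤ (λ eq → r≢r₀ (proj₁ eq)))))
          (K.trans (SK.∑-single (K₂ r₀) s₀ _ s₀≤ (λ s s≤ s≢s₀ → off r₀≤ s≤ (λ eq → s≢s₀ (proj₂ eq))))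
            (K.reflexive (≡.trans (δ-same (xe r₀ s₀) _) (δ-same (ze r₀ s₀) _))))
        where
        off : ∀ {r s} → r ≤ K₁ → s ≤ K₂ r → ¬ (r ≡ r₀ × s ≡ s₀) →
              δ (xe r s) (xe r₀ s₀) (δ (ze r s) (ze r₀ s₀) (coeff (D r s) j)) K.≈ K.0#
        off {r} {s} r≤ s≤ ≢₀ with xe r s ℕ.≟ xe r₀ s₀ | ze r s ℕ.≟ ze r₀ s₀
        ... | yes xe≡ | yes ze≡ = ⊥-elim (≢₀ (inj r≤ s≤ r₀≤ s₀≤ xe≡ ze≡))
        ... | yes _   | no ze≢  = K.reflexive (≡.trans (≡.cong (δ (xe r s) _) (δ-diff _ ze≢)) (δ-0 (xe r s) _))
        ... | no xe≢  | _       = K.reflexive (δ-diff _ xe≢)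

    ∑∑-independent : ∀ D → ∑∑ D ≈ 0# → ∀ {r s} → r ≤ K₁ → s ≤ K₂ r → ∀ j → coeff (D r s) j K.≈ K.0#
    ∑∑-independent D ∑∑D≈0 {r} {s} r≤ s≤ j = by-cases (j ℕ.≤? M)
      where
      bound : ∃ λ M → ∀ r s → r ≤ K₁ → s ≤ K₂ r → xe r s +ℕ ze r s +ℕ length (D r s) ≤ M
      bound = upper-bound₂ K₁ K₂ (λ r s → xe r s +ℕ ze r s +ℕ length (D r s))
      M : ℕ
      M = proj₁ bound
      bounds : ∀ r s → r ≤ K₁ → s ≤ K₂ r → xe r s ≤ M × ze r s ≤ M × length (D r s) ≤ M
      bounds r s r≤ s≤ = let sum≤ = proj₂ bound r s r≤ s≤ in
        ℕ.m+n≤o⇒m≤o (xe r s) (ℕ.m+n≤o⇒m≤o (xe r s +ℕ ze r s) sum≤) , ℕ.m+n≤o⇒n≤o (xe r s) (ℕ.m+n≤o⇒m≤o (xe r s +ℕ ze r s) sum≤) ,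
        ℕ.m+n≤o⇒n≤o (xe r s +ℕ ze r s) sum≤
      by-cases : Dec (j ≤ M) → coeff (D r s) j K.≈ K.0#
      by-cases (yes j≤M) = let (xe≤ , ze≤ , _) = bounds r s r≤ s≤ in
        K.trans (K.sym (δ-coeffs-pick D r≤ s≤ j))
          (IsPBWBasis.independent pbw M (δ-coeffs D) (trans (combo-δ-coeffs M D bounds) ∑∑D≈0) _ j _ xe≤ j≤M ze≤)
      by-cases (no j≰M) =
        K.reflexive (coeff-beyond-length (D r s) j (ℕ.≤-trans (proj₂ (proj₂ (bounds r s r≤ s≤))) (ℕ.<⇒≤ (ℕ.≰⇒> j≰M))))

    ∑∑-unique : ∀ D D′ → ∑∑ D′ ≈ ∑∑ D → ∀ {r s} → r ≤ K₁ → s ≤ K₂ r → D′ r s ≋ D r s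
    ∑∑-unique D D′ ∑∑D′≈∑∑D r≤ s≤ j = x∙y⁻¹≈ε⇒x≈y _ _
      (K.trans (K.sym (coeff--P (D′ _ _) (D _ _) j)) (∑∑-independent (λ r s → D′ r s -P D r s) difference≈0 r≤ s≤ j))
      where
      split : ∑∑ D′ ≈ ∑∑ D + ∑∑ (λ r s → D′ r s -P D r s)
      split = trans (∑-cong K₁ (λ r _ → trans (∑-cong (K₂ r) (λ s _ →
                trans (term-cong (xe r s) (ze r s) (ev--P (D′ r s) (D r s) y)) (term-+ (xe r s) (ev (D r s) y) _ (ze r s)))) (∑-distrib-∙ (K₂ r) _ _)))
                (∑-distrib-∙ K₁ _ _)
      difference≈0 : ∑∑ (λ r s → D′ r s -P D r s) ≈ 0#
      difference≈0 = +-identityʳ-unique (∑∑ D) _ (trans (sym split) ∑∑D′≈∑∑D)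

  ∸-exponents-injective : ∀ {K M} N → K ≤ M → IndexInjective K (λ _ → 0) (λ r _ → M ∸ r) (λ r _ → N ∸ r)
  ∸-exponents-injective N K≤M r≤K s≤0 r′≤K s′≤0 M∸r≡M∸r′ _ =
    ℕ.∸-cancelˡ-≡ (ℕ.≤-trans r≤K K≤M) (ℕ.≤-trans r′≤K K≤M) M∸r≡M∸r′ , ≡.trans (ℕ.n≤0⇒n≡0 s≤0) (≡.sym (ℕ.n≤0⇒n≡0 s′≤0))

  Σ-x^∸z^∸-unique : ∀ K M N (D D′ : ℕ → Pol) → K ≤ M →
    Σ≤ K (λ r → term (M ∸ r) (ev (D′ r) y) (N ∸ r)) ≈ Σ≤ K (λ r → term (M ∸ r) (ev (D r) y) (N ∸ r)) →
    ∀ r → r ≤ K → D′ r ≋ D r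
  Σ-x^∸z^∸-unique K M N D D′ K≤M same r r≤K =
    Independence.∑∑-unique K (λ _ → 0) (λ r _ → M ∸ r) (λ r _ → N ∸ r) (∸-exponents-injective N K≤M)
      (λ r _ → D r) (λ r _ → D′ r) same r≤K z≤n

  ΣΣ-x^z^-unique : ∀ K (D D′ : ℕ → ℕ → Pol) →
    Σ≤ K (λ i → Σ≤ (K ∸ i) (λ k → term i (ev (D′ i k) y) k)) ≈ Σ≤ K (λ i → Σ≤ (K ∸ i) (λ k → term i (ev (D i k) y) k)) →
    ∀ i k → i +ℕ k ≤ K → D′ i k ≋ D i k
  ΣΣ-x^z^-unique K D D′ same i k i+k≤K =
    Independence.∑∑-unique K (K ∸_) (λ i _ → i) (λ _ k → k) (λ _ _ _ _ i≡i′ k≡k′ → i≡i′ , k≡k′) D D′ same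
      (ℕ.m+n≤o⇒m≤o i i+k≤K) (ℕ.m+n≤o⇒m≤o∸n k (≡.subst (_≤ K) (ℕ.+-comm i k) i+k≤K))

proposition3p9 :
  ∀ {c ℓ a ℓa : Level} (F : Field c ℓ) → CharZero F →
  (α αi β b : Field.Carrier F) →
  ¬ (Field._≈_ F α (Field.0# F)) → ¬ (Field._≈_ F β (Field.0# F)) →
  Field._≈_ F (Field._*_ F α αi) (Field.1# F) →
  (A : FAlgebra F a ℓa) (x y z : FAlgebra.Carrier A) →
  let open FAlgebra A
      open Poly F
      open Families F α αi β b
      ev : Pol → Carrier
      ev p = evalP A p y
  in
  -- defining relations of A
  (y * z - ι α * (z * y) ≈ 0#) →
  (z * x - ι β * (x * z) ≈ y + ι b) →
  (x * y - ι α * (y * x) ≈ 0#) →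
  -- the standard monomials x^i y^j z^k form a basis of A
  IsPBWBasis A x y z →
  -- (1)
  ((∀ m n → (y ^ n) * (x ^ m) ≈ ι (Field._^_ F αi (m *ℕ n)) * ((x ^ m) * (y ^ n)))
   × (∀ m n → (z ^ n) * (y ^ m) ≈ ι (Field._^_ F αi (m *ℕ n)) * ((y ^ m) * (z ^ n)))
   × (∀ m n → (z ^ n) * (x ^ m)
              ≈ Σ≤ (m ⊓ n) (λ k → (x ^ (m ∸ k)) * ev (W m n k) * (z ^ (n ∸ k))))
   × (∀ m n (W′ : ℕ → Pol) →
        (z ^ n) * (x ^ m) ≈ Σ≤ (m ⊓ n) (λ k → (x ^ (m ∸ k)) * ev (W′ k) * (z ^ (n ∸ k))) →
        ∀ k → k ≤ m ⊓ n → W′ k ≋ W m n k))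
  -- (2)
  × ((∀ m n s → ((x ^ n) * (y ^ m)) ^ s
                ≈ ι (Field._^_ F αi (m *ℕ n *ℕ (s C 2))) * ((x ^ (n *ℕ s)) * (y ^ (m *ℕ s))))
     × (∀ m n s → ((y ^ n) * (z ^ m)) ^ s
                ≈ ι (Field._^_ F αi (m *ℕ n *ℕ (s C 2))) * ((y ^ (n *ℕ s)) * (z ^ (m *ℕ s))))
     × (∀ n m s → ((x ^ n) * (z ^ m)) ^ s
                ≈ Σ≤ ((n *ℕ s) ⊓ (m *ℕ s))
                    (λ ℓ′ → (x ^ (n *ℕ s ∸ ℓ′)) * ev (U n m s ℓ′) * (z ^ (m *ℕ s ∸ ℓ′)))))
  -- (3)
  × ((∀ s → (x * y * z) ^ s ≈ Σ≤ s (λ ℓ′ → (x ^ (s ∸ ℓ′)) * ev (V s ℓ′) * (z ^ (s ∸ ℓ′))))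
     × (∀ s (V′ : ℕ → Pol) →
          (x * y * z) ^ s ≈ Σ≤ s (λ ℓ′ → (x ^ (s ∸ ℓ′)) * ev (V′ ℓ′) * (z ^ (s ∸ ℓ′))) →
          ∀ ℓ′ → ℓ′ ≤ s → V′ ℓ′ ≋ V s ℓ′))
  -- (4)
  × ((∀ n m t s → ((x ^ n) * (y ^ m) * (z ^ t)) ^ s
                  ≈ Σ≤ ((n *ℕ s) ⊓ (t *ℕ s))
                      (λ ℓ′ → (x ^ (n *ℕ s ∸ ℓ′)) * ev (R n m t s ℓ′) * (z ^ (t *ℕ s ∸ ℓ′))))
     × (∀ n m t s (R′ : ℕ → Pol) →
          ((x ^ n) * (y ^ m) * (z ^ t)) ^ s
            ≈ Σ≤ ((n *ℕ s) ⊓ (t *ℕ s))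
                (λ ℓ′ → (x ^ (n *ℕ s ∸ ℓ′)) * ev (R′ ℓ′) * (z ^ (t *ℕ s ∸ ℓ′))) →
          ∀ ℓ′ → ℓ′ ≤ (n *ℕ s) ⊓ (t *ℕ s) → R′ ℓ′ ≋ R n m t s ℓ′))
  -- (5)
  × ((∀ n → (x + y) ^ n ≈ Σ≤ n (λ k → ι (qbin αi n k) * ((x ^ (n ∸ k)) * (y ^ k))))
     × (∀ n → (y + z) ^ n ≈ Σ≤ n (λ k → ι (qbin αi n k) * ((y ^ (n ∸ k)) * (z ^ k))))
     × (∀ n → (x + z) ^ n
              ≈ Σ≤ n (λ i → Σ≤ (n ∸ i) (λ k → (x ^ i) * ev (E n i k) * (z ^ k))))
     × (∀ n (E′ : ℕ → ℕ → Pol) →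
          (x + z) ^ n ≈ Σ≤ n (λ i → Σ≤ (n ∸ i) (λ k → (x ^ i) * ev (E′ i k) * (z ^ k))) →
          ∀ i k → i +ℕ k ≤ n → E′ i k ≋ E n i k))
proposition3p9 F _ α αi β b _ _ α*αi≈1 A x y z yz-relation zx-relation xy-relation pbw =
    ( ^-commute αi y*x , ^-commute αi z*y , z^*x^
    , λ m n W′ same → Σ-x^∸z^∸-unique (m ⊓ n) m n (W m n) W′ (ℕ.m⊓n≤m m n) (trans (sym same) (z^*x^ m n)))
  , (^-of-product αi y*x , ^-of-product αi z*y , x^z^-power)
  , ( xyz-power
    , λ s V′ same → Σ-x^∸z^∸-unique s s s (V s) V′ ℕ.≤-refl (trans (sym same) (xyz-power s)))
  , ( Powers.R-expansion
    , λ n m t s R′ same → Σ-x^∸z^∸-unique _ (n *ℕ s) (t *ℕ s) (R n m t s) R′ (ℕ.m⊓n≤m _ _)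
                            (trans (sym same) (Powers.R-expansion n m t s)))
  , ( q-binomial αi y*x , q-binomial αi z*y , x+z-power
    , λ n E′ same → ΣΣ-x^z^-unique n (E n) E′ (trans (sym same) (x+z-power n)))
  where
  open FAlgebra A
  open AlgebraFacts F A
  open Families F α αi β b
  open FamiliesInA F α αi β b A using (q-binomial)
  open Uniqueness F A x y z pbw

  y*x : y * x ≈ ι αi * (x * y)
  y*x = commutation-inverse α*αi≈1 xy-relation

  z*y : z * y ≈ ι αi * (y * z)
  z*y = commutation-inverse α*αi≈1 yz-relation

  open QCommuting using (^-commute; ^-of-product)
  open NormalOrdering.Expansions F α αi β b A x y z y*x z*y (x-y≈z⇒x≈y+z zx-relation)
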